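{- Let $\mathsf{L}$ be $\mathsf{CK}$ extended by any subset of the axioms $\mathsf{ID}$, $\mathsf{MP}$, $\mathsf{CEM}$, and let $\mathsf{L}_g$ be the corresponding Gentzen rule set listed below. Then for every formula $A$, $\mathsf{G}\mathsf{L}_g\vdash A$ whenever $\mathsf{H}\mathsf{L}\vdash A$. Moreover, the cut rule $\frac{\Gamma,A\quad\Delta,\neg A}{\Gamma,\Delta}$ is admissible in $\mathsf{G}\mathsf{L}_g$.
   Context: Fix a set $V$ of propositional variables and $\Lambda=\{\Rightarrow\}$ (binary, infix). Formulas: $A ::= \bot\mid p\mid\neg A\mid A\land B\mid A\Rightarrow B$ ($p\in V$); $\top,\lor,\to,\leftrightarrow$ abbreviations. Sequents: finite multisets of formulas ($\Gamma,\Delta$ union; formulas = singletons). Rules: $\Gamma_1\dots\Gamma_n/\Gamma_0$, $n\ge0$. Hilbert: $\mathsf{H}\mathsf{R}\vdash A$ iff $A$ is in the least set of formulas containing substitution instances of propositional tautologies, closed under modus ponens, and containing $\bigvee\Gamma_0$ whenever it contains $\bigvee\Gamma_1,\dots,\bigvee\Gamma_n$ for $\Gamma_1\dots\Gamma_n/\Gamma_0\in\mathsf{R}$ ($\bigvee$ = disjunction of a sequent). Gentzen: $\mathsf{G}\mathsf{R}\vdash\Gamma$ iff $\Gamma$ is in the least set of sequents containing $A,\neg A,\Gamma$ and $\neg\bot,\Gamma$ for all $A,\Gamma$, closed under $\frac{\Gamma,\neg A,\neg B}{\Gamma,\neg(A\land B)}$, $\frac{\Gamma,A\quad\Gamma,B}{\Gamma,A\land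 B}$, $\frac{\Gamma,A}{\Gamma,\neg\neg A}$ and under the rules of $\mathsf{R}$. A rule set is admissible in $\mathsf{G}\mathsf{R}$ if adding it to $\mathsf{R}$ does not change the set of derivable sequents. Hilbert rule sets: $\mathsf{CK}$ = all instances of $\frac{A\leftrightarrow A'}{(A\Rightarrow B)\leftrightarrow(A'\Rightarrow B)}$ and $\frac{B_1\land\dots\land B_n\to B}{(A\Rightarrow B_1)\land\dots\land(A\Rightarrow B_n)\to(A\Rightarrow B)}$ ($n\ge0$; $n=0$ reads $B/(A\Rightarrow B)$). Axioms (all instances): $(\mathsf{ID})$ $A\Rightarrow A$; $(\mathsf{MP})$ $(A\Rightarrow B)\to(A\to B)$; $(\mathsf{CEM})$ $(A\Rightarrow B)\lor(A\Rightarrow\neg B)$. An extension is named by juxtaposition, e.g. $\mathsf{CK}\mathsf{MP}\mathsf{CEM}$. Gentzen rules (all instances, any formulas and sequents $\Gamma$); "$A_0=\dots=A_n$" denotes the premises $\neg A_0,A_i$ and $\neg A_i,A_0$ ($1\le i\le n$): $(\mathsf{CK}_g)$ $\frac{A_0=\dots=A_n\quad \neg B_1,\dots,\neg B_n,B_0}{\neg(A_1\Rightarrow B_1),\dots,\neg(A_n\Rightarrow B_n),(A_0\Rightarrow B_0),\Gamma}$ ($n\ge0$); $(\mathsf{CKID}_g)$ the same with second premise $\neg A_0,\neg B_1,\dots,\neg B_n,B_0$; $(\mathsf{MP}_g)$ $\frac{A,\neg(A\Rightarrow B),\Gamma\quad\neg B,\neg(A\Rightarrow B),\Gamma}{\neg(A\Rightarrow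 B),\Gamma}$; $(\mathsf{CKCEM}_g)$ $\frac{A_0=\dots=A_n\quad B_0,\dots,B_j,\neg B_{j+1},\dots,\neg B_n}{(A_0\Rightarrow B_0),\dots,(A_j\Rightarrow B_j),\neg(A_{j+1}\Rightarrow B_{j+1}),\dots,\neg(A_n\Rightarrow B_n),\Gamma}$ ($0\le j\le n$); $(\mathsf{CKCEMID}_g)$ the same with $\neg A_0$ added to the second premise; $(\mathsf{MPCEM}_g)$ $\frac{A,(A\Rightarrow B),\Gamma\quad B,(A\Rightarrow B),\Gamma}{(A\Rightarrow B),\Gamma}$. Correspondence $\mathsf{L}\mapsto\mathsf{L}_g$: $\mathsf{CK}\mapsto\{\mathsf{CK}_g\}$; $\mathsf{CKID}\mapsto\{\mathsf{CKID}_g\}$; $\mathsf{CKMP}\mapsto\{\mathsf{CK}_g,\mathsf{MP}_g\}$; $\mathsf{CKMPID}\mapsto\{\mathsf{CKID}_g,\mathsf{MP}_g\}$; $\mathsf{CKCEM}\mapsto\{\mathsf{CKCEM}_g\}$; $\mathsf{CKCEMID}\mapsto\{\mathsf{CKCEMID}_g\}$; $\mathsf{CKCEMMP}\mapsto\{\mathsf{CKCEM}_g,\mathsf{MP}_g,\mathsf{MPCEM}_g\}$; $\mathsf{CKCEMMPID}\mapsto\{\mathsf{CKCEMID}_g,\mathsf{MP}_g,\mathsf{MPCEM}_g\}$ (each meaning the set of all instances of the listed rules). -}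

module Defs where

open import Data.Nat using (ℕ)
open import Data.Bool using (Bool; true; false; _∧_; not)
open import Data.List using (List; []; _∷_; _++_; map; concatMap)
open import Data.List.Relation.Unary.All using (All)
open import Data.List.Relation.Binary.Permutation.Propositional using (_↭_)
open import Data.Product using (_×_; _,_; proj₁; proj₂; Σ; ∃)
open import Data.Sum using (_⊎_)
open import Relation.Binary.PropositionalEquality using (_≡_)

data Formula (V : Set) : Set where
  ⊥'   : Formula V
  var  : V → Formula V
  ¬'_  : Formula V → Formula V
  _∧'_ : Formula V → Formula V → Formula V
  _⇒_  : Formula V → Formula V → Formula V

infix  9 ¬'_
infixr 7 _∧'_
infixr 6 _∨'_
infixr 5 _⊃_ _⟺_
infixr 8 _⇒_

⊤' : {V : Set} → Formula V
⊤' = ¬' ⊥'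

_∨'_ : {V : Set} → Formula V → Formula V → Formula V
A ∨' B = ¬' (¬' A ∧' ¬' B)

_⊃_ : {V : Set} → Formula V → Formula V → Formula V
A ⊃ B = ¬' (A ∧' ¬' B)

_⟺_ : {V : Set} → Formula V → Formula V → Formula V
A ⟺ B = (A ⊃ B) ∧' (B ⊃ A)

data PForm : Set where
  p⊥   : PForm
  pvar : ℕ → PForm
  p¬   : PForm → PForm
  p∧   : PForm → PForm → PForm

peval : (ℕ → Bool) → PForm → Bool
peval v p⊥ = false
peval v (pvar n) = v n
peval v (p¬ φ) = not (peval v φ)
peval v (p∧ φ ψ) = peval v φ ∧ peval v ψ

Tautology : PForm → Set
Tautology φ = ∀ (v : ℕ → Bool) → peval v φ ≡ true

psubst : {V : Set} → (ℕ → Formula V) → PForm → Formula V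
psubst σ p⊥ = ⊥'
psubst σ (pvar n) = σ n
psubst σ (p¬ φ) = ¬' psubst σ φ
psubst σ (p∧ φ ψ) = psubst σ φ ∧' psubst σ ψ

TautInstance : {V : Set} → Formula V → Set
TautInstance {V} A = Σ PForm λ φ → Σ (ℕ → Formula V) λ σ → Tautology φ × psubst σ φ ≡ A

-- Sequents (finite multisets, represented by lists up to permutation)
-- and rules

Sequent : Set → Set
Sequent V = List (Formula V)

record Rule (V : Set) : Set where
  constructor _/_
  field
    premises   : List (Sequent V)
    conclusion : Sequent V
open Rule public
infix 1 _/_

RuleSet : Set → Set₁
RuleSet V = Rule V → Set

_∪_ : {V : Set} → RuleSet V → RuleSet V → RuleSet V
(R ∪ S) r = R r ⊎ S r

⋁ : {V : Set} → Sequent V → Formula V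
⋁ [] = ⊥'
⋁ (A ∷ []) = A
⋁ (A ∷ B ∷ Γ) = A ∨' ⋁ (B ∷ Γ)

data H⊢ {V : Set} (R : RuleSet V) : Formula V → Set where
  taut : ∀ {A} → TautInstance A → H⊢ R A
  mpH  : ∀ {A B} → H⊢ R (A ⊃ B) → H⊢ R A → H⊢ R B
  rule : ∀ {ps c} → R (ps / c) → All (λ Γ → H⊢ R (⋁ Γ)) ps → H⊢ R (⋁ c)

-- Gentzen derivability G R ⊢ Γ
-- (sequents are multisets: derivability is closed under permutation)

data G⊢ {V : Set} (R : RuleSet V) : Sequent V → Set where
  perm  : ∀ {Γ Δ} → Γ ↭ Δ → G⊢ R Γ → G⊢ R Δ
  ax    : ∀ A Γ → G⊢ R (A ∷ ¬' A ∷ Γ)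
  ax⊥   : ∀ Γ → G⊢ R (¬' ⊥' ∷ Γ)
  ¬∧    : ∀ {Γ A B} → G⊢ R (¬' A ∷ ¬' B ∷ Γ) → G⊢ R (¬' (A ∧' B) ∷ Γ)
  ∧r    : ∀ {Γ A B} → G⊢ R (A ∷ Γ) → G⊢ R (B ∷ Γ) → G⊢ R (A ∧' B ∷ Γ)
  ¬¬    : ∀ {Γ A} → G⊢ R (A ∷ Γ) → G⊢ R (¬' ¬' A ∷ Γ)
  rule  : ∀ {ps c} → R (ps / c) → All (G⊢ R) ps → G⊢ R c

Admissible : {V : Set} → RuleSet V → RuleSet V → Set
Admissible R S = ∀ Γ → G⊢ (R ∪ S) Γ → G⊢ R Γ

data Cut {V : Set} : RuleSet V where
  cut : ∀ Γ Δ A → Cut (((A ∷ Γ) ∷ (¬' A ∷ Δ) ∷ []) / (Γ ++ Δ))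

⋀⁺ : {V : Set} → Formula V → List (Formula V) → Formula V
⋀⁺ B [] = B
⋀⁺ B (C ∷ Cs) = B ∧' ⋀⁺ C Cs

data CK {V : Set} : RuleSet V where
  ck-cong : ∀ A A' B →
    CK (((A ⟺ A') ∷ []) ∷ [] / (((A ⇒ B) ⟺ (A' ⇒ B)) ∷ []))
  ck-mono0 : ∀ A B →
    CK ((B ∷ []) ∷ [] / ((A ⇒ B) ∷ []))
  ck-mono : ∀ A B B₁ Bs →
    CK ((((⋀⁺ B₁ Bs) ⊃ B) ∷ []) ∷ []
        / ((⋀⁺ (A ⇒ B₁) (map (A ⇒_) Bs) ⊃ (A ⇒ B)) ∷ []))

data IDax {V : Set} : RuleSet V where
  id-ax : ∀ A → IDax ([] / ((A ⇒ A) ∷ []))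

data MPax {V : Set} : RuleSet V where
  mp-ax : ∀ A B → MPax ([] / (((A ⇒ B) ⊃ (A ⊃ B)) ∷ []))

data CEMax {V : Set} : RuleSet V where
  cem-ax : ∀ A B → CEMax ([] / (((A ⇒ B) ∨' (A ⇒ ¬' B)) ∷ []))

data Empty {V : Set} : RuleSet V where

opt : {V : Set} → Bool → RuleSet V → RuleSet V
opt true R = R
opt false R = Empty

HL : {V : Set} → (id mp cem : Bool) → RuleSet V
HL i m c = CK ∪ (opt i IDax ∪ (opt m MPax ∪ opt c CEMax))

-- premises  A₀ = A₁ = … = Aₙ
eqPrems : {V : Set} → Formula V → List (Formula V × Formula V) → List (Sequent V)
eqPrems A₀ = concatMap (λ p → (¬' A₀ ∷ proj₁ p ∷ []) ∷ (¬' proj₁ p ∷ A₀ ∷ []) ∷ [])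

negImp : {V : Set} → Formula V × Formula V → Formula V
negImp p = ¬' (proj₁ p ⇒ proj₂ p)

posImp : {V : Set} → Formula V × Formula V → Formula V
posImp p = proj₁ p ⇒ proj₂ p

negB : {V : Set} → Formula V × Formula V → Formula V
negB p = ¬' proj₂ p

idPart : {V : Set} → Bool → Formula V → Sequent V
idPart true A = ¬' A ∷ []
idPart false A = []

-- extra: the list of formulas added to the second premise
-- ([] for the plain rule, ¬A₀ for the ID variant)
data CKg' {V : Set} (withID : Bool) : RuleSet V where
  ckg : ∀ A₀ B₀ (ps : List (Formula V × Formula V)) Γ →
    CKg' withID ((eqPrems A₀ ps ++
                   ((idPart withID A₀ ++ map negB ps ++ B₀ ∷ []) ∷ []))
                 / (map negImp ps ++ (A₀ ⇒ B₀) ∷ Γ))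

data CKCEMg' {V : Set} (withID : Bool) : RuleSet V where
  ckcemg : ∀ A₀ B₀ (pos neg : List (Formula V × Formula V)) Γ →
    CKCEMg' withID ((eqPrems A₀ (pos ++ neg) ++
                     ((idPart withID A₀ ++ B₀ ∷ map proj₂ pos ++ map negB neg) ∷ []))
                   / ((A₀ ⇒ B₀) ∷ map posImp pos ++ map negImp neg ++ Γ))

data MPg {V : Set} : RuleSet V where
  mpg : ∀ A B Γ →
    MPg (((A ∷ ¬' (A ⇒ B) ∷ Γ) ∷ (¬' B ∷ ¬' (A ⇒ B) ∷ Γ) ∷ [])
         / (¬' (A ⇒ B) ∷ Γ))

data MPCEMg {V : Set} : RuleSet V where
  mpcemg : ∀ A B Γ →
    MPCEMg (((A ∷ (A ⇒ B) ∷ Γ) ∷ (B ∷ (A ⇒ B) ∷ Γ) ∷ [])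
            / ((A ⇒ B) ∷ Γ))

GL : {V : Set} → (id mp cem : Bool) → RuleSet V
GL i false false = CKg' i
GL i true  false = CKg' i ∪ MPg
GL i false true  = CKCEMg' i
GL i true  true  = CKCEMg' i ∪ (MPg ∪ MPCEMg)

module Submission where

-- Both claims are proved through an auxiliary sequent calculus D (module Calculus), equivalent to
-- G L_g but tailored to proof transformations: derivations carry a height, axioms only close on
-- atoms (variables and conditionals) or ¬⊥, every logical rule has a single principal formula,
-- and all conditional rules of L_g are one modal rule over a list of signed conditionals ±(A ⇒ B)
-- anchored at a positive one.  Principal
--      cuts on conditionals are reduced to MP steps (mpElim) or to a single merged modal step
--      (merge), which needs cuts of lower degree only.
--   3. Translation: G (L_g ∪ Cut) derivations map into D (cuts by 2), D maps back into G L_g.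
--   4. Tautologies, Hilbert: theorems of H L are derivable in D (tautology instances by proof
--      search, modus ponens by cut, the CK rules and the axioms by modal and MP steps).

open import Defs
open import Data.Bool using (Bool; true; false; not; _∧_)
open import Data.Nat using (ℕ; zero; suc; _+_; _≤_; _<_; _⊔_; s≤s)
import Data.Nat as ℕ
open import Data.Nat.Properties using (≤-refl; ≤-trans; m≤m⊔n; m≤n⊔m; n≤1+n; ≤-pred; <⇒≤; m≤m+n; m≤n+m; +-monoˡ-≤; +-suc; +-assoc)
open import Data.Bool.Properties using (not-involutive)
open import Data.List using (List; []; _∷_; _++_; [_]; map)
open import Data.List.Relation.Unary.All as All using (All; []; _∷_)
open import Data.List.Relation.Unary.Any using (Any; here; there; any?)
open import Data.List.Membership.Propositional using (_∈_; find)
open import Data.List.Membership.Propositional.Properties using (∈-∃++; ∈-++⁻; ∈-map⁻; ∈-map⁺; ∈-++⁺ˡ; ∈-++⁺ʳ)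
open import Data.List.Relation.Binary.Permutation.Propositional
open import Data.List.Relation.Binary.Permutation.Propositional.Properties
open import Data.Product using (_×_; _,_; proj₁; proj₂; Σ; map₁; map₂)
open import Data.Sum using (_⊎_; inj₁; inj₂)
open import Data.Empty using (⊥; ⊥-elim)
open import Relation.Binary.PropositionalEquality using (_≡_; refl; sym; subst; cong; cong₂) renaming (trans to ≡-trans)
open import Relation.Nullary using (Dec; yes; no; does)
import Algebra.Solver.CommutativeMonoid as CMSolver
import Data.List.Relation.Unary.All.Properties as AllP
import Data.List.Properties as ListP

module Perm {A : Set} where
  -- Normalises permutation goals between concatenations of lists.
  open CMSolver (++-commutativeMonoid {A = A}) public

  ∈⇒↭ : ∀ {x : A} {xs} → x ∈ xs → Σ (List A) λ ys → xs ↭ x ∷ ys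
  ∈⇒↭ {x} x∈ with ∈-∃++ x∈
  ... | ys , zs , refl = ys ++ zs , shift x ys zs

  split : ∀ {x : A} {Γ} (M G : List A) → x ∷ Γ ↭ M ++ G →
    (Σ (List A) λ M' → (M ↭ x ∷ M') × (Γ ↭ M' ++ G)) ⊎
    (Σ (List A) λ G' → (G ↭ x ∷ G') × (Γ ↭ M ++ G'))
  split {x} M G p with ∈-++⁻ M (∈-resp-↭ p (here refl))
  ... | inj₁ x∈M with ∈⇒↭ x∈M
  ...   | M' , q = inj₁ (M' , q , drop-∷ (↭-trans p (++⁺ʳ G q)))
  split {x} M G p | inj₂ x∈G with ∈⇒↭ x∈G
  ...   | G' , q = inj₂ (G' , q , drop-∷ (↭-trans p (↭-trans (++⁺ˡ M q) (shift x M G'))))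

  split₁ : ∀ {x y : A} {Γ Δ} → x ∷ Γ ↭ y ∷ Δ →
    (x ≡ y × Γ ↭ Δ) ⊎ (Σ (List A) λ R → (Γ ↭ y ∷ R) × (Δ ↭ x ∷ R))
  split₁ {y = y} {Δ = Δ} p with split [ y ] Δ p
  ... | inj₁ (M' , q , r) with ↭-singleton-inv (↭-sym q)
  ...   | refl = inj₁ (refl , r)
  split₁ p | inj₂ (R , q , r) = inj₂ (R , r , q)

  data Dup (y : A) (M G Δ : List A) : Set where
    bothLeft  : ∀ {M'} → M ↭ y ∷ y ∷ M' → Δ ↭ M' ++ G → Dup y M G Δ
    oneEach   : ∀ {M' G'} → M ↭ y ∷ M' → G ↭ y ∷ G' → Δ ↭ M' ++ G' → Dup y M G Δ
    bothRight : ∀ {G'} → G ↭ y ∷ y ∷ G' → Δ ↭ M ++ G' → Dup y M G Δ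

  dup : ∀ {y : A} M G {Δ} → y ∷ y ∷ Δ ↭ M ++ G → Dup y M G Δ
  dup {y} M G p with split M G p
  ... | inj₁ (M' , q , r) with split M' G r
  ...   | inj₁ (M'' , q' , r') = bothLeft (↭-trans q (prep y q')) r'
  ...   | inj₂ (G' , q' , r') = oneEach q q' r'
  dup {y} M G p | inj₂ (G' , q , r) with split M G' r
  ...   | inj₁ (M' , q' , r') = oneEach q' q r'
  ...   | inj₂ (G'' , q' , r') = bothRight (↭-trans q (prep y q')) r'

-- Derivations are indexed by a height (needed for contraction).
module Calculus {V : Set} (i m c : Bool) where
  Fm : Set
  Fm = Formula V
  Seq : Set
  Seq = List Fm
  open Perm public

  data Atom : Fm → Set where
    atVar : ∀ v → Atom (var v)
    atImp : ∀ A B → Atom (A ⇒ B)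

  data Axiom (X : Seq) : Set where
    atomic : ∀ {P} → Atom P → P ∈ X → ¬' P ∈ X → Axiom X
    verum  : ¬' ⊥' ∈ X → Axiom X

  axiom-mono : ∀ {X Y} → (∀ {F} → F ∈ X → F ∈ Y) → Axiom X → Axiom Y
  axiom-mono f (atomic a p n) = atomic a (f p) (f n)
  axiom-mono f (verum v) = verum (f v)

  axiom-↭ : ∀ {X Y} → Axiom X → X ↭ Y → Axiom Y
  axiom-↭ a p = axiom-mono (∈-resp-↭ p) a

  data AxiomView : Fm → Seq → Set where
    side        : ∀ {F Γ} → Axiom Γ → AxiomView F Γ
    closesPos   : ∀ {P Γ} → Atom P → ¬' P ∈ Γ → AxiomView P Γ
    closesNeg   : ∀ {P Γ} → Atom P → P ∈ Γ → AxiomView (¬' P) Γ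
    closesVerum : ∀ {Γ} → AxiomView (¬' ⊥') Γ

  axiomView : ∀ {F Γ} → Axiom (F ∷ Γ) → AxiomView F Γ
  axiomView (atomic a (here refl) (here ()))
  axiomView (atomic a (here refl) (there n)) = closesPos a n
  axiomView (atomic a (there p) (here refl)) = closesNeg a p
  axiomView (atomic a (there p) (there n)) = side (atomic a p n)
  axiomView (verum (here refl)) = closesVerum
  axiomView (verum (there v)) = side (verum v)

  data Cond : Set where
    cond : Bool → Fm → Fm → Cond

  formula : Cond → Fm
  formula (cond true A B) = A ⇒ B
  formula (cond false A B) = ¬' (A ⇒ B)

  -- The consequent, with the sign of the conditional; it is what the modal premise contains.
  lit : Cond → Fm
  lit (cond true A B) = B
  lit (cond false A B) = ¬' B

  ant : Cond → Fm
  ant (cond _ A _) = A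

  Negative : Cond → Set
  Negative (cond s _ _) = s ≡ false

  -- A modal step is anchored at a positive conditional A₀ ⇒ B₀ of E; without CEM all
  -- remaining conditionals are negative (rules CK/CKID), with CEM they are arbitrary (CKCEM/CKCEMID).
  Anchored : Fm → List Cond → Set
  Anchored A₀ E = Σ Fm λ B₀ → Σ (List Cond) λ E' →
    (E ↭ cond true A₀ B₀ ∷ E') × (c ≡ false → All Negative E')

  data LR : Fm → Set where
    conj  : ∀ A B → LR (A ∧' B)
    nconj : ∀ A B → LR (¬' (A ∧' B))
    nneg  : ∀ A → LR (¬' ¬' A)
    mp    : m ≡ true → ∀ A B → LR (¬' (A ⇒ B))
    mpcem : m ≡ true → c ≡ true → ∀ A B → LR (A ⇒ B)

  -- Side formulas of the premises; the context of the conclusion is appended to each.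
  prems : ∀ {F} → LR F → List Seq
  prems (conj A B) = [ A ] ∷ [ B ] ∷ []
  prems (nconj A B) = (¬' A ∷ ¬' B ∷ []) ∷ []
  prems (nneg A) = [ A ] ∷ []
  prems (mp _ A B) = (A ∷ ¬' (A ⇒ B) ∷ []) ∷ (¬' B ∷ ¬' (A ⇒ B) ∷ []) ∷ []
  prems (mpcem _ _ A B) = (A ∷ (A ⇒ B) ∷ []) ∷ (B ∷ (A ⇒ B) ∷ []) ∷ []

  -- D n X: X has a derivation of height at most n.  The modal rule md has the premises
  -- A₀ = ant e for all e in E and (¬A₀ under ID,) the literals of E, and concludes E plus context G.
  data D : ℕ → Seq → Set
  Prems : ℕ → Seq → List Seq → Set
  Prems n G = All (λ M → D n (M ++ G))
  Equiv : ℕ → Fm → Fm → Set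
  Equiv n A B = D n (¬' A ∷ B ∷ []) × D n (¬' B ∷ A ∷ [])
  EqAnt : ℕ → Fm → List Cond → Set
  EqAnt n A₀ = All (λ e → Equiv n A₀ (ant e))
  data D where
    ax : ∀ {n X} → Axiom X → D n X
    lr : ∀ {n X F} G (r : LR F) → Prems n G (prems r) → X ↭ F ∷ G → D (suc n) X
    md : ∀ {n X} A₀ E G → Anchored A₀ E → EqAnt n A₀ E →
         D n (idPart i A₀ ++ map lit E) → X ↭ map formula E ++ G → D (suc n) X

  data CondAt (E : List Cond) (K : Seq) : Fm → Set where
    atPos : ∀ {A B R} → E ↭ cond true A B ∷ R → K ↭ map formula R → CondAt E K (A ⇒ B)
    atNeg : ∀ {A B R} → E ↭ cond false A B ∷ R → K ↭ map formula R → CondAt E K (¬' (A ⇒ B))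

  condAt : ∀ {F E K} → map formula E ↭ F ∷ K → CondAt E K F
  condAt {E = E} p with ∈-map⁻ formula (∈-resp-↭ (↭-sym p) (here refl))
  ... | e , e∈ , refl with ∈⇒↭ e∈
  ...   | R , q = at e q (drop-∷ (↭-trans (↭-sym p) (map⁺ formula q)))
    where at : ∀ e {R K} → E ↭ e ∷ R → K ↭ map formula R → CondAt E K (formula e)
          at (cond true A B) = atPos
          at (cond false A B) = atNeg

  condAt₂ : ∀ {F E K} → map formula E ↭ F ∷ F ∷ K →
    Σ Cond λ e → Σ (List Cond) λ R → (E ↭ e ∷ e ∷ R) × (F ≡ formula e) × (K ↭ map formula R)
  condAt₂ p with condAt p
  ... | atPos {A} {B} q r with condAt (↭-sym r)
  ...   | atPos q' r' = cond true A B , _ , ↭-trans q (prep _ q') , refl , r'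
  condAt₂ p | atNeg {A} {B} q r with condAt (↭-sym r)
  ...   | atNeg q' r' = cond false A B , _ , ↭-trans q (prep _ q') , refl , r'

  anchored-dedup : ∀ {A₀ E e R} → Anchored A₀ E → E ↭ e ∷ e ∷ R → Anchored A₀ (e ∷ R)
  anchored-dedup {R = R} (B₀ , E' , t , neg) u with split₁ (↭-trans (↭-sym t) u)
  ... | inj₁ (refl , w) = B₀ , R , ↭-refl , λ cf → All.tail (All-resp-↭ w (neg cf))
  ... | inj₂ (Q , w₁ , w₂) = B₀ , Q , w₂ , λ cf → All.tail (All-resp-↭ w₁ (neg cf))

  liftLe : ∀ {n k X} → n ≤ k → D n X → D k X
  liftPrems : ∀ {n k G Ms} → n ≤ k → Prems n G Ms → Prems k G Ms
  liftEqAnt : ∀ {n k A₀ E} → n ≤ k → EqAnt n A₀ E → EqAnt k A₀ E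
  liftLe _ (ax a) = ax a
  liftLe (s≤s p) (lr G r ps q) = lr G r (liftPrems p ps) q
  liftLe (s≤s p) (md A₀ E G s eqs d q) = md A₀ E G s (liftEqAnt p eqs) (liftLe p d) q
  liftPrems p [] = []
  liftPrems p (d ∷ ds) = liftLe p d ∷ liftPrems p ds
  liftEqAnt p [] = []
  liftEqAnt p ((d , d') ∷ ds) = (liftLe p d , liftLe p d') ∷ liftEqAnt p ds

  liftD : ∀ {n X} → D n X → D (suc n) X
  liftD = liftLe (n≤1+n _)

  permD : ∀ {n X Y} → D n X → X ↭ Y → D n Y
  permD (ax a) q = ax (axiom-↭ a q)
  permD (lr G r ps p) q = lr G r ps (↭-trans (↭-sym q) p)
  permD (md A₀ E G s eqs d p) q = md A₀ E G s eqs d (↭-trans (↭-sym q) p)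

  wkD : ∀ {n X} F → D n X → D n (F ∷ X)
  wkPrems : ∀ {n G Ms} F → Prems n G Ms → Prems n (F ∷ G) Ms
  wkD F (ax a) = ax (axiom-mono there a)
  wkD F (lr G r ps p) = lr (F ∷ G) r (wkPrems F ps) (↭-trans (prep F p) (swap F _ ↭-refl))
  wkD F (md A₀ E G s eqs d p) = md A₀ E (F ∷ G) s eqs d (↭-trans (prep F p) (↭-sym (shift F (map formula E) G)))
  wkPrems F [] = []
  wkPrems {G = G} F (_∷_ {x = M} d ds) = permD (wkD F d) (↭-sym (shift F M G)) ∷ wkPrems F ds

  wkL : ∀ {n X} L → D n X → D n (L ++ X)
  wkL [] d = d
  wkL (F ∷ L) d = wkD F (wkL L d)

  wkR : ∀ {n X} L → D n X → D n (X ++ L)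
  wkR {X = X} L d = permD (wkL L d) (++-comm L X)

  absorb : ∀ {n F Γ Δ} → F ∈ Γ → D n (F ∷ Δ) → D n (Γ ++ Δ)
  absorb {F = F} {Δ = Δ} F∈ d with ∈⇒↭ F∈
  ... | R , q = permD (wkL R d) (↭-trans (shift F R Δ) (↭-sym (++⁺ʳ Δ q)))

  module Inversion (F : Fm) (N : Seq)
    (inert : ∀ {Γ} → AxiomView F Γ → Axiom Γ)
    (notCond : ∀ {E K} → CondAt E K F → ⊥)
    (principal : ∀ {n G} (r : LR F) → Prems n G (prems r) → D n (N ++ G)) where

    inv : ∀ {n X Γ} → D n X → X ↭ F ∷ Γ → D n (N ++ Γ)
    invPrems : ∀ {n G G' Ms} → Prems n G Ms → G ↭ F ∷ G' → Prems n (N ++ G') Ms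
    inv (ax a) q = ax (axiom-mono (∈-++⁺ʳ N) (inert (axiomView (axiom-↭ a q))))
    inv (lr G r ps p) q with split₁ (↭-trans (↭-sym q) p)
    ... | inj₁ (refl , w) = liftD (permD (principal r ps) (++⁺ˡ N (↭-sym w)))
    ... | inj₂ (R , w₁ , w₂) = lr (N ++ R) r (invPrems ps w₂) (↭-trans (++⁺ˡ N w₁) (shift _ N R))
    inv (md A₀ E G s eqs d p) q with split (map formula E) G (↭-trans (↭-sym q) p)
    ... | inj₁ (K , r₁ , _) = ⊥-elim (notCond (condAt r₁))
    ... | inj₂ (G' , r₁ , r₂) = md A₀ E (N ++ G') s eqs d (↭-trans (++⁺ˡ N r₂) (shifts N (map formula E)))
    invPrems [] _ = []
    invPrems {G' = G'} (_∷_ {x = M} d ds) r =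
      permD (inv d (↭-trans (++⁺ˡ M r) (shift F M G'))) (shifts N M) ∷ invPrems ds r

  inv∧ˡ : ∀ {n X Γ A B} → D n X → X ↭ (A ∧' B) ∷ Γ → D n (A ∷ Γ)
  inv∧ˡ {A = A} {B} = Inversion.inv (A ∧' B) [ A ]
    (λ { (side a) → a ; (closesPos () _) }) (λ ()) (λ { (conj A B) (d ∷ _) → d })

  inv∧ʳ : ∀ {n X Γ A B} → D n X → X ↭ (A ∧' B) ∷ Γ → D n (B ∷ Γ)
  inv∧ʳ {A = A} {B} = Inversion.inv (A ∧' B) [ B ]
    (λ { (side a) → a ; (closesPos () _) }) (λ ()) (λ { (conj A B) (_ ∷ d ∷ _) → d })

  inv¬∧ : ∀ {n X Γ A B} → D n X → X ↭ ¬' (A ∧' B) ∷ Γ → D n (¬' A ∷ ¬' B ∷ Γ)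
  inv¬∧ {A = A} {B} = Inversion.inv (¬' (A ∧' B)) (¬' A ∷ ¬' B ∷ [])
    (λ { (side a) → a ; (closesPos () _) ; (closesNeg () _) }) (λ ()) (λ { (nconj A B) (d ∷ _) → d })

  inv¬¬ : ∀ {n X Γ A} → D n X → X ↭ ¬' ¬' A ∷ Γ → D n (A ∷ Γ)
  inv¬¬ {A = A} = Inversion.inv (¬' ¬' A) [ A ]
    (λ { (side a) → a ; (closesPos () _) ; (closesNeg () _) }) (λ ()) (λ { (nneg A) (d ∷ _) → d })

  inv⊥ : ∀ {n X Γ} → D n X → X ↭ ⊥' ∷ Γ → D n Γ
  inv⊥ = Inversion.inv ⊥' [] (λ { (side a) → a ; (closesPos () _) }) (λ ()) (λ ())

  -- Height-preserving contraction, simultaneously for lists of formulas, for the premises of a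
  -- rule whose context contains the duplicate, and for a duplicated principal formula (by inversion).
  ctr : ∀ {n X F Γ} → D n X → X ↭ F ∷ F ∷ Γ → D n (F ∷ Γ)
  ctrL : ∀ {n} L {X} → D n (L ++ L ++ X) → D n (L ++ X)
  ctrPrems : ∀ {n F G G' Ms} → Prems n G Ms → G ↭ F ∷ F ∷ G' → Prems n (F ∷ G') Ms
  ctrPrincipal : ∀ {n F G Γ} (r : LR F) → Prems n G (prems r) → G ↭ F ∷ Γ → Prems n Γ (prems r)
  ctrUnder : ∀ {n F G Γ} S → D n (S ∷ F ∷ G) → G ↭ F ∷ Γ → D n (S ∷ F ∷ Γ)

  ctr {F = F} {Γ} (ax a) q = ax (axiom-mono (λ x∈ → merge (∈-resp-↭ q x∈)) a)
    where merge : ∀ {x} → x ∈ F ∷ F ∷ Γ → x ∈ F ∷ Γ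
          merge (here e) = here e
          merge (there x∈) = x∈
  ctr (lr G r ps p) q with dup [ _ ] G (↭-trans (↭-sym q) p)
  ... | bothLeft s _ with ↭-length s
  ...   | ()
  ctr (lr G r ps p) q | oneEach s t w with ↭-singleton-inv (↭-sym s)
  ...   | refl = lr _ r (ctrPrincipal r ps (↭-trans t (prep _ (↭-sym w)))) ↭-refl
  ctr (lr G r ps p) q | bothRight t w = lr _ r (ctrPrems ps t) (↭-trans (prep _ w) (swap _ _ ↭-refl))
  ctr {n = suc n} {F = F} (md A₀ E G s eqs d p) q with dup (map formula E) G (↭-trans (↭-sym q) p)
  ... | bothLeft s₁ w with condAt₂ s₁
  ...   | e , R , u , refl , v =
    md A₀ (e ∷ R) G (anchored-dedup s u) (All.tail (All-resp-↭ u eqs)) premise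
      (prep _ (↭-trans w (++⁺ʳ G v)))
    where
    premise : D n (idPart i A₀ ++ lit e ∷ map lit R)
    premise = permD (ctr d (↭-trans (++⁺ˡ (idPart i A₀) (map⁺ lit u)) (shifts (idPart i A₀) (lit e ∷ lit e ∷ []))))
                    (↭-sym (shift (lit e) (idPart i A₀) (map lit R)))
  ctr (md A₀ E G s eqs d p) q | oneEach {G' = G'} s₁ t w =
    md A₀ E G' s eqs d (↭-trans (prep _ w) (↭-sym (++⁺ʳ G' s₁)))
  ctr (md A₀ E G s eqs d p) q | bothRight {G'} t w =
    md A₀ E (_ ∷ G') s eqs d (↭-trans (prep _ w) (↭-sym (shift _ (map formula E) G')))

  ctrL [] d = d
  ctrL (F ∷ L) {X} d =
    permD (ctrL L {F ∷ X} (permD (ctr d (prep F (shift F L (L ++ X))))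
                                (solve 3 (λ f l x → f ⊕ (l ⊕ (l ⊕ x)) ⊜ l ⊕ (l ⊕ (f ⊕ x))) ↭-refl [ F ] L X)))
          (shift F L X)

  ctrPrems [] t = []
  ctrPrems {F = F} {G' = G'} (_∷_ {x = M} d ds) t =
    permD (ctr d (↭-trans (++⁺ˡ M t) (shifts M (F ∷ F ∷ [])))) (↭-sym (shift F M G')) ∷ ctrPrems ds t

  ctrPrincipal (conj A B) (d₁ ∷ d₂ ∷ []) t =
    ctrL [ A ] (inv∧ˡ d₁ (↭-trans (prep A t) (swap _ _ ↭-refl))) ∷
    ctrL [ B ] (inv∧ʳ d₂ (↭-trans (prep B t) (swap _ _ ↭-refl))) ∷ []
  ctrPrincipal (nconj A B) (d ∷ []) t =
    ctrL (¬' A ∷ ¬' B ∷ []) (inv¬∧ d (↭-trans (prep _ (prep _ t)) (shifts (¬' A ∷ ¬' B ∷ []) [ _ ]))) ∷ []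
  ctrPrincipal (nneg A) (d ∷ []) t = ctrL [ A ] (inv¬¬ d (↭-trans (prep A t) (swap _ _ ↭-refl))) ∷ []
  ctrPrincipal (mp _ A B) (d₁ ∷ d₂ ∷ []) t = ctrUnder A d₁ t ∷ ctrUnder (¬' B) d₂ t ∷ []
  ctrPrincipal (mpcem _ _ A B) (d₁ ∷ d₂ ∷ []) t = ctrUnder A d₁ t ∷ ctrUnder B d₂ t ∷ []

  ctrUnder {F = F} S d t =
    permD (ctr d (↭-trans (prep S (prep F t)) (shifts [ S ] (F ∷ F ∷ [])))) (swap F S ↭-refl)

  ⊢_ : Seq → Set
  ⊢ X = Σ ℕ λ n → D n X

  Prems⊢ : Seq → List Seq → Set
  Prems⊢ G = All (λ M → ⊢ (M ++ G))

  Equiv⊢ : Fm → Fm → Set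
  Equiv⊢ A B = ⊢ (¬' A ∷ B ∷ []) × ⊢ (¬' B ∷ A ∷ [])

  EqAnt⊢ : Fm → List Cond → Set
  EqAnt⊢ A₀ = All (λ e → Equiv⊢ A₀ (ant e))

  perm⊢ : ∀ {X Y} → ⊢ X → X ↭ Y → ⊢ Y
  perm⊢ (n , d) q = n , permD d q

  wkL⊢ : ∀ L {X} → ⊢ X → ⊢ (L ++ X)
  wkL⊢ L (n , d) = n , wkL L d

  ctrL⊢ : ∀ L {X} → ⊢ (L ++ L ++ X) → ⊢ (L ++ X)
  ctrL⊢ L (n , d) = n , ctrL L d

  byAxiom : ∀ {X} → Axiom X → ⊢ X
  byAxiom a = zero , ax a

  forgetEqAnt : ∀ {n A₀ E} → EqAnt n A₀ E → EqAnt⊢ A₀ E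
  forgetEqAnt [] = []
  forgetEqAnt ((d , d') ∷ ds) = ((_ , d) , (_ , d')) ∷ forgetEqAnt ds

  commonPrems : ∀ {G Ms} → Prems⊢ G Ms → Σ ℕ λ k → Prems k G Ms
  commonPrems [] = zero , []
  commonPrems ((n , d) ∷ ds) with commonPrems ds
  ... | k , ds' = n ⊔ k , liftLe (m≤m⊔n n k) d ∷ liftPrems (m≤n⊔m n k) ds'

  commonEqAnt : ∀ {A₀ E} → EqAnt⊢ A₀ E → Σ ℕ λ k → EqAnt k A₀ E
  commonEqAnt [] = zero , []
  commonEqAnt (((n , d) , (n' , d')) ∷ ds) with commonEqAnt ds
  ... | k , ds' = (n ⊔ n') ⊔ k ,
    (liftLe (≤-trans (m≤m⊔n n n') (m≤m⊔n _ k)) d , liftLe (≤-trans (m≤n⊔m n n') (m≤m⊔n _ k)) d')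
    ∷ liftEqAnt (m≤n⊔m _ k) ds'

  byRule : ∀ {X F} G (r : LR F) → Prems⊢ G (prems r) → X ↭ F ∷ G → ⊢ X
  byRule G r ps p with commonPrems ps
  ... | k , ds = suc k , lr G r ds p

  byModal : ∀ {X} A₀ E G → Anchored A₀ E → EqAnt⊢ A₀ E → ⊢ (idPart i A₀ ++ map lit E) →
            X ↭ map formula E ++ G → ⊢ X
  byModal A₀ E G s eqs (n , d) p with commonEqAnt eqs
  ... | k , ds = suc (k ⊔ n) , md A₀ E G s (liftEqAnt (m≤m⊔n k n) ds) (liftLe (m≤n⊔m k n) d) p

-- Cut admissibility in D.  Cuts are eliminated level by level: CutAt w allows cuts whose
-- formula and contexts all have modal degree ≤ w, and level w is proved assuming level w - 1.
module CutElimination {V : Set} (i m c : Bool) where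
  open Calculus {V} i m c

  δ : Fm → ℕ
  δ ⊥' = zero
  δ (var _) = zero
  δ (¬' A) = δ A
  δ (A ∧' B) = δ A ⊔ δ B
  δ (A ⇒ B) = suc (δ A ⊔ δ B)

  Bnd : ℕ → Seq → Set
  Bnd w = All (λ F → δ F ≤ w)

  CutAt : ℕ → Set
  CutAt w = ∀ C {Γ Δ} → δ C ≤ w → Bnd w Γ → Bnd w Δ → ⊢ (C ∷ Γ) → ⊢ (¬' C ∷ Δ) → ⊢ (Γ ++ Δ)

  conjˡ : ∀ {w} A B → δ (A ∧' B) ≤ w → δ A ≤ w
  conjˡ A B = ≤-trans (m≤m⊔n (δ A) (δ B))

  conjʳ : ∀ {w} A B → δ (A ∧' B) ≤ w → δ B ≤ w
  conjʳ A B = ≤-trans (m≤n⊔m (δ A) (δ B))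

  ant< : ∀ A B → δ A < δ (A ⇒ B)
  ant< A B = s≤s (m≤m⊔n (δ A) (δ B))

  cns< : ∀ A B → δ B < δ (A ⇒ B)
  cns< A B = s≤s (m≤n⊔m (δ A) (δ B))

  antBound : ∀ {w} A B → δ (A ⇒ B) ≤ w → δ A ≤ w
  antBound A B = ≤-trans (<⇒≤ (ant< A B))

  cnsBound : ∀ {w} A B → δ (A ⇒ B) ≤ w → δ B ≤ w
  cnsBound A B = ≤-trans (<⇒≤ (cns< A B))

  antBound⁺ : ∀ {w} A B → δ (A ⇒ B) ≤ suc w → δ A ≤ w
  antBound⁺ A B b = ≤-pred (≤-trans (ant< A B) b)

  cnsBound⁺ : ∀ {w} A B → δ (A ⇒ B) ≤ suc w → δ B ≤ w
  cnsBound⁺ A B b = ≤-pred (≤-trans (cns< A B) b)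

  bmono : ∀ {w w' X} → w ≤ w' → Bnd w X → Bnd w' X
  bmono p = All.map (λ q → ≤-trans q p)

  premBounds : ∀ {w F} (r : LR F) → δ F ≤ w → All (Bnd w) (prems r)
  premBounds (conj A B) b = (conjˡ A B b ∷ []) ∷ (conjʳ A B b ∷ []) ∷ []
  premBounds (nconj A B) b = (conjˡ A B b ∷ conjʳ A B b ∷ []) ∷ []
  premBounds (nneg A) b = (b ∷ []) ∷ []
  premBounds (mp _ A B) b = (antBound A B b ∷ b ∷ []) ∷ (cnsBound A B b ∷ b ∷ []) ∷ []
  premBounds (mpcem _ _ A B) b = (antBound A B b ∷ b ∷ []) ∷ (cnsBound A B b ∷ b ∷ []) ∷ []

  formulaBound : ∀ {w} s A B → δ (A ⇒ B) ≤ w → δ (formula (cond s A B)) ≤ w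
  formulaBound true A B b = b
  formulaBound false A B b = b

  CondBnd : ℕ → List Cond → Set
  CondBnd w = All (λ e → δ (ant e) ≤ w × δ (lit e) ≤ w)

  condBounds : ∀ {w} E → Bnd (suc w) (map formula E) → CondBnd w E
  condBounds [] [] = []
  condBounds (cond true A B ∷ E) (b ∷ bs) = (antBound⁺ A B b , cnsBound⁺ A B b) ∷ condBounds E bs
  condBounds (cond false A B ∷ E) (b ∷ bs) = (antBound⁺ A B b , cnsBound⁺ A B b) ∷ condBounds E bs

  litBounds : ∀ {w E} → CondBnd w E → Bnd w (map lit E)
  litBounds bs = AllP.map⁺ (All.map proj₂ bs)

  anchorBound : ∀ {w A₀ E} → Anchored A₀ E → CondBnd w E → δ A₀ ≤ w
  anchorBound (_ , _ , t , _) bs = proj₁ (All.head (All-resp-↭ t bs))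

  idBound : ∀ {w} b A → δ A ≤ w → Bnd w (idPart b A)
  idBound true A p = p ∷ []
  idBound false A p = []

  -- Cuts on a variable: only an axiom can introduce it, so the right derivation is reused.
  cutVar : ∀ {v n₁ n₂ X Γ Δ} → D n₁ X → X ↭ var v ∷ Γ → D n₂ (¬' var v ∷ Δ) → ⊢ (Γ ++ Δ)
  cutVarPrems : ∀ {v n₁ n₂ G G' Δ Ms} → Prems n₁ G Ms → G ↭ var v ∷ G' → D n₂ (¬' var v ∷ Δ) →
                Prems⊢ (G' ++ Δ) Ms
  cutVar {Γ = Γ} (ax a) q d₂ with axiomView (axiom-↭ a q)
  ... | side a' = byAxiom (axiom-mono ∈-++⁺ˡ a')
  ... | closesPos _ n = _ , absorb n d₂
  cutVar {Δ = Δ} (lr G r ps p) q d₂ with split₁ (↭-trans (↭-sym q) p)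
  ... | inj₁ (refl , _) with r
  ...   | ()
  cutVar {Δ = Δ} (lr G r ps p) q d₂ | inj₂ (R , w₁ , w₂) = byRule (R ++ Δ) r (cutVarPrems ps w₂ d₂) (++⁺ʳ Δ w₁)
  cutVar {Γ = Γ} {Δ} (md A₀ E G s eqs dd p) q d₂ with split (map formula E) G (↭-trans (↭-sym q) p)
  ... | inj₁ (K , r₁ , _) with condAt r₁
  ...   | ()
  cutVar {Γ = Γ} {Δ} (md A₀ E G s eqs dd p) q d₂ | inj₂ (G' , r₁ , r₂) =
    _ , md A₀ E (G' ++ Δ) s eqs dd (↭-trans (++⁺ʳ Δ r₂) (++-assoc (map formula E) G' Δ))
  cutVarPrems [] _ _ = []
  cutVarPrems {G' = G'} {Δ} (_∷_ {x = M} d ds) t d₂ =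
    perm⊢ (cutVar d (↭-trans (++⁺ˡ M t) (shift _ M G')) d₂) (++-assoc M G' Δ) ∷ cutVarPrems ds t d₂

  chain : ∀ {w X Y Z} → CutAt w → δ X ≤ w → δ Y ≤ w → δ Z ≤ w →
          ⊢ (¬' X ∷ Y ∷ []) → ⊢ (¬' Y ∷ Z ∷ []) → ⊢ (¬' X ∷ Z ∷ [])
  chain {Y = Y} cutL bX bY bZ d₁ d₂ = cutL Y bY (bX ∷ []) (bZ ∷ []) (perm⊢ d₁ (swap _ _ ↭-refl)) d₂

  reanchor : ∀ {w A A₀ L} → CutAt w → (b : Bool) → δ A ≤ w → δ A₀ ≤ w → Bnd w L →
             ⊢ (¬' A ∷ A₀ ∷ []) → ⊢ (idPart b A₀ ++ L) → ⊢ (idPart b A ++ L)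
  reanchor cutL false _ _ _ _ d = d
  reanchor {A₀ = A₀} cutL true bA bA₀ bL e d = cutL A₀ bA₀ (bA ∷ []) bL (perm⊢ e (swap _ _ ↭-refl)) d

  collapse : ∀ {w A₀ A₀' L₁ L₂} → CutAt w → (b : Bool) → δ A₀ ≤ w → δ A₀' ≤ w → Bnd w L₁ → Bnd w L₂ →
             ⊢ (¬' A₀' ∷ A₀ ∷ []) → ⊢ ((idPart b A₀ ++ L₁) ++ (idPart b A₀' ++ L₂)) →
             ⊢ (idPart b A₀' ++ L₂ ++ L₁)
  collapse {L₁ = L₁} {L₂} cutL false _ _ _ _ _ d = perm⊢ d (++-comm L₁ L₂)
  collapse {A₀ = A₀} {A₀'} {L₁} {L₂} cutL true b₀ b₀' bL₁ bL₂ e d =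
    ctrL⊢ [ ¬' A₀' ] (perm⊢ (cutL A₀ b₀ (b₀' ∷ []) (AllP.++⁺ bL₁ (b₀' ∷ bL₂)) (perm⊢ e (swap _ _ ↭-refl)) d)
      (solve 3 (λ a l₁ l₂ → a ⊕ (l₁ ⊕ (a ⊕ l₂)) ⊜ a ⊕ (a ⊕ (l₂ ⊕ l₁))) ↭-refl [ ¬' A₀' ] L₁ L₂))

  Positive : Cond → Set
  Positive (cond s _ _) = s ≡ true

  -- An entry can be discharged by an MP rule: MP for negative entries, MPCEM for positive ones.
  MPReady : Cond → Set
  MPReady e = Positive e → c ≡ true

  positiveNotNegative : true ≡ false → ⊥
  positiveNotNegative ()

  negativeReady : ∀ {e} → Negative e → MPReady e
  negativeReady {cond false _ _} _ ()

  allReady : ∀ {R} → c ≡ true → All MPReady R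
  allReady ct = All.tabulate (λ _ _ → ct)

  readyIf : ∀ {R} → (c ≡ false → All Negative R) → All MPReady R
  readyIf {R} neg = byCEM c refl
    where byCEM : ∀ b → c ≡ b → All MPReady R
          byCEM true ct = allReady ct
          byCEM false cf = All.map negativeReady (neg cf)

  restNegative : ∀ {A₀ E A B R} → Anchored A₀ E → E ↭ cond true A B ∷ R → c ≡ false → All Negative R
  restNegative (B₀ , E' , t , neg) u cf with split₁ (↭-trans (↭-sym t) u)
  ... | inj₁ (refl , w) = All-resp-↭ w (neg cf)
  ... | inj₂ (_ , w₁ , _) = ⊥-elim (positiveNotNegative (All.head (All-resp-↭ w₁ (neg cf))))

  readyRest : ∀ {A₀ E A B R} → Anchored A₀ E → E ↭ cond true A B ∷ R → All MPReady R
  readyRest s u = readyIf (restNegative s u)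

  anchored-merge : ∀ {A₀ A₀' E₁ E₂ A B R₁ R₂} → Anchored A₀ E₁ → E₁ ↭ cond true A B ∷ R₁ →
                   Anchored A₀' E₂ → E₂ ↭ cond false A B ∷ R₂ → Anchored A₀' (R₂ ++ R₁)
  anchored-merge {R₁ = R₁} s₁ u₁ (B₀' , E₂' , t₂ , neg₂) u₂ with split₁ (↭-trans (↭-sym t₂) u₂)
  ... | inj₁ (() , _)
  ... | inj₂ (R' , w₁ , w₂) = B₀' , R' ++ R₁ , ++⁺ʳ R₁ w₂ ,
    λ cf → AllP.++⁺ (All.tail (All-resp-↭ w₁ (neg₂ cf))) (restNegative s₁ u₁ cf)

  mpStep : ∀ {X G} e → m ≡ true → MPReady e → ⊢ (ant e ∷ X) → ⊢ (lit e ∷ X) → X ↭ formula e ∷ G → ⊢ X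
  mpStep {G = G} (cond true A B) mt ready d₁ d₂ t =
    byRule G (mpcem mt (ready refl) A B) (perm⊢ d₁ (prep A t) ∷ perm⊢ d₂ (prep B t) ∷ []) t
  mpStep {G = G} (cond false A B) mt _ d₁ d₂ t =
    byRule G (mp mt A B) (perm⊢ d₁ (prep A t) ∷ perm⊢ d₂ (prep (¬' B) t) ∷ []) t

  mpSteps : m ≡ true → ∀ R {Ctx H} → All MPReady R → All (λ r → ⊢ (ant r ∷ Ctx)) R →
            Ctx ↭ map formula R ++ H → ⊢ (map lit R ++ Ctx) → ⊢ Ctx
  mpSteps mt [] _ _ _ d = d
  mpSteps mt (r ∷ R) {Ctx} {H} (ok ∷ oks) (a ∷ as) t d =
    mpSteps mt R oks as t' (mpStep r mt ok (perm⊢ (wkL⊢ (map lit R) a) (shift (ant r) (map lit R) Ctx)) d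
      (↭-trans (++⁺ˡ (map lit R) t) (shift (formula r) (map lit R) (map formula R ++ H))))
    where t' : Ctx ↭ map formula R ++ formula r ∷ H
          t' = ↭-trans t (↭-sym (shift (formula r) (map formula R) H))

  -- Principal cut between two modal steps on A ⇒ B and ¬(A ⇒ B): the result is a single modal
  -- step on the remaining conditionals, obtained with cuts of lower degree on B and on antecedents.
  merge : ∀ {w A B A₀ A₀' E₁ E₂ R₁ R₂ k₁ k₂} G → CutAt w → CondBnd w E₁ → CondBnd w E₂ →
          Anchored A₀ E₁ → EqAnt k₁ A₀ E₁ → D k₁ (idPart i A₀ ++ map lit E₁) → E₁ ↭ cond true A B ∷ R₁ →
          Anchored A₀' E₂ → EqAnt k₂ A₀' E₂ → D k₂ (idPart i A₀' ++ map lit E₂) → E₂ ↭ cond false A B ∷ R₂ →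
          ⊢ (map formula (R₂ ++ R₁) ++ G)
  merge {w} {A} {B} {A₀} {A₀'} {E₁} {E₂} {R₁} {R₂} {k₁} {k₂} G cutL eb₁ eb₂ s₁ eqs₁ dd₁ t₁ s₂ eqs₂ dd₂ t₂ =
    byModal A₀' (R₂ ++ R₁) G (anchored-merge s₁ t₁ s₂ t₂)
      (AllP.++⁺ (forgetEqAnt (All.tail eq₂)) (reanchorEq (All.tail hb₁) (All.tail eq₁)))
      (subst (λ L → ⊢ (idPart i A₀' ++ L)) (sym (ListP.map-++ lit R₂ R₁))
        (collapse cutL i b₀ b₀' (litBounds (All.tail hb₁)) (litBounds (All.tail hb₂)) to₀ litsCut))
      ↭-refl
    where
    hb₁ : CondBnd w (cond true A B ∷ R₁)
    hb₁ = All-resp-↭ t₁ eb₁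
    hb₂ : CondBnd w (cond false A B ∷ R₂)
    hb₂ = All-resp-↭ t₂ eb₂
    bA : δ A ≤ w
    bA = proj₁ (All.head hb₁)
    b₀ : δ A₀ ≤ w
    b₀ = anchorBound s₁ eb₁
    b₀' : δ A₀' ≤ w
    b₀' = anchorBound s₂ eb₂
    eq₁ : EqAnt k₁ A₀ (cond true A B ∷ R₁)
    eq₁ = All-resp-↭ t₁ eqs₁
    eq₂ : EqAnt k₂ A₀' (cond false A B ∷ R₂)
    eq₂ = All-resp-↭ t₂ eqs₂
    to₀ : ⊢ (¬' A₀' ∷ A₀ ∷ [])
    to₀ = chain cutL b₀' bA b₀ (_ , proj₁ (All.head eq₂)) (_ , proj₂ (All.head eq₁))
    from₀ : ⊢ (¬' A₀ ∷ A₀' ∷ [])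
    from₀ = chain cutL b₀ bA b₀' (_ , proj₁ (All.head eq₁)) (_ , proj₂ (All.head eq₂))
    reanchorEq : ∀ {R} → CondBnd w R → EqAnt k₁ A₀ R → EqAnt⊢ A₀' R
    reanchorEq [] [] = []
    reanchorEq ((ba , _) ∷ bs) ((d , d') ∷ ds) =
      (chain cutL b₀' b₀ ba to₀ (_ , d) , chain cutL ba b₀ b₀' (_ , d') from₀) ∷ reanchorEq bs ds
    litsCut : ⊢ ((idPart i A₀ ++ map lit R₁) ++ (idPart i A₀' ++ map lit R₂))
    litsCut = cutL B (proj₂ (All.head hb₁))
      (AllP.++⁺ (idBound i A₀ b₀) (litBounds (All.tail hb₁))) (AllP.++⁺ (idBound i A₀' b₀') (litBounds (All.tail hb₂)))
      (_ , permD dd₁ (↭-trans (++⁺ˡ (idPart i A₀) (map⁺ lit t₁)) (shift B (idPart i A₀) (map lit R₁))))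
      (_ , permD dd₂ (↭-trans (++⁺ˡ (idPart i A₀') (map⁺ lit t₂)) (shift (¬' B) (idPart i A₀') (map lit R₂))))

  data PosIntro (k : ℕ) (A B : Fm) (Γ : Seq) : Set where
    viaMPCEM : ∀ {G} → m ≡ true → c ≡ true →
               D k (A ∷ (A ⇒ B) ∷ G) → D k (B ∷ (A ⇒ B) ∷ G) → Γ ↭ G → PosIntro k A B Γ
    viaModal : ∀ {A₀ E R G} → Anchored A₀ E → EqAnt k A₀ E → D k (idPart i A₀ ++ map lit E) →
               E ↭ cond true A B ∷ R → Γ ↭ map formula R ++ G → PosIntro k A B Γ

  mpcemIntro : ∀ {k A B G Γ} (r : LR (A ⇒ B)) → Prems k G (prems r) → Γ ↭ G → PosIntro k A B Γ
  mpcemIntro (mpcem mt ct _ _) (p₁ ∷ p₂ ∷ []) u = viaMPCEM mt ct p₁ p₂ u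

  -- The formula an MP rule pairs with the literal of ±(A ⇒ B) to discharge it.
  opposite : Bool → Fm → Fm
  opposite true B = ¬' B
  opposite false B = B

  dupL : ∀ L → ⊢ (L ++ L) → ⊢ L
  dupL L d = perm⊢ (ctrL⊢ L {[]} (perm⊢ d (++⁺ˡ L (↭-sym (++-identityʳ L))))) (++-identityʳ L)

  positiveLevel : ∀ {k w} → suc k ≤ w → Σ ℕ λ w' → w ≡ suc w'
  positiveLevel {w = suc w'} (s≤s _) = w' , refl

  module Level (w : ℕ) (lower : ∀ {w'} → w ≡ suc w' → CutAt w') where

    condsBound : ∀ {s A B E R G Γ} → δ (A ⇒ B) ≤ w → Bnd w Γ → E ↭ cond s A B ∷ R →
                 Γ ↭ map formula R ++ G → Bnd w (map formula E)
    condsBound {s} b bΓ t u =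
      All-resp-↭ (↭-sym (map⁺ formula t)) (formulaBound s _ _ b ∷ AllP.++⁻ˡ _ (All-resp-↭ u bΓ))

    -- Cut on C by recursion on C; for A ⇒ B by recursion on the left derivation (cutCond) until
    -- A ⇒ B is principal, then on the right derivation (cutIntro) until ¬(A ⇒ B) is principal.
    -- Every recursive call shrinks the cut formula, the left height, or the right derivation.
    cutFormula : CutAt w
    cutCond : ∀ A B {Γ Δ n₁ n₂ X} → δ (A ⇒ B) ≤ w → Bnd w Γ → Bnd w Δ →
              D n₁ X → X ↭ (A ⇒ B) ∷ Γ → D n₂ (¬' (A ⇒ B) ∷ Δ) → ⊢ (Γ ++ Δ)
    cutCondPrems : ∀ A B {G G' Δ n₁ n₂ Ms} → δ (A ⇒ B) ≤ w → All (Bnd w) Ms → Bnd w G' → Bnd w Δ →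
                   Prems n₁ G Ms → G ↭ (A ⇒ B) ∷ G' → D n₂ (¬' (A ⇒ B) ∷ Δ) → Prems⊢ (G' ++ Δ) Ms
    cutIntro : ∀ A B {Γ Δ k n Y} → δ (A ⇒ B) ≤ w → Bnd w Γ → Bnd w Δ →
               ⊢ ((A ⇒ B) ∷ Γ) → PosIntro k A B Γ → D n Y → Y ↭ ¬' (A ⇒ B) ∷ Δ → ⊢ (Γ ++ Δ)
    cutIntroPrems : ∀ A B {Γ G G' k n Ms} → δ (A ⇒ B) ≤ w → Bnd w Γ → All (Bnd w) Ms → Bnd w G' →
                    ⊢ ((A ⇒ B) ∷ Γ) → PosIntro k A B Γ → Prems n G Ms → G ↭ ¬' (A ⇒ B) ∷ G' →
                    Prems⊢ (Γ ++ G') Ms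
    -- Principal cut against an MP step: via a cut on B (left MPCEM) or via mpElim (left modal).
    cutIntroMP : ∀ A B {Γ Δ G k n} → δ (A ⇒ B) ≤ w → Bnd w Γ → Bnd w Δ →
                 ⊢ ((A ⇒ B) ∷ Γ) → PosIntro k A B Γ → (r : LR (¬' (A ⇒ B))) → Prems n G (prems r) →
                 Δ ↭ G → ⊢ (¬' (A ⇒ B) ∷ Δ) → ⊢ (Γ ++ Δ)
    -- Principal cut against a modal step: via mpElim (left MPCEM) or via merge (left modal).
    cutIntroModal : ∀ A B {Γ Δ k n A₀ E R G} → δ (A ⇒ B) ≤ w → Bnd w Γ → Bnd w Δ →
                    PosIntro k A B Γ → Anchored A₀ E → EqAnt n A₀ E → D n (idPart i A₀ ++ map lit E) →
                    E ↭ cond false A B ∷ R → Δ ↭ map formula R ++ G → ⊢ (¬' (A ⇒ B) ∷ Δ) → ⊢ (Γ ++ Δ)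
    -- A modal step with an entry ±(A ⇒ B) is replaced by MP steps once A and the opposite literal
    -- are derivable in a context already containing the other conditionals R of the step.
    mpElim : ∀ s A B {k A₀ E R Ctx H} → δ (A ⇒ B) ≤ w → Bnd w Ctx → Anchored A₀ E → EqAnt k A₀ E →
             D k (idPart i A₀ ++ map lit E) → E ↭ cond s A B ∷ R → Ctx ↭ map formula R ++ H → m ≡ true →
             All MPReady R → ⊢ (A ∷ Ctx) → ⊢ (opposite s B ∷ Ctx) → ⊢ Ctx

    cutFormula ⊥' {Γ} {Δ} _ _ _ (_ , d₁) _ = _ , wkR Δ (inv⊥ d₁ ↭-refl)
    cutFormula (var v) _ _ _ (_ , d₁) (_ , d₂) = cutVar d₁ ↭-refl d₂
    cutFormula (¬' C) {Γ} {Δ} b bΓ bΔ d₁ (_ , d₂) = perm⊢ (cutFormula C b bΔ bΓ (_ , inv¬¬ d₂ ↭-refl) d₁) (++-comm Δ Γ)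
    cutFormula (A ∧' B) {Γ} {Δ} b bΓ bΔ (_ , d₁) (_ , d₂) =
      ctrL⊢ Γ (cutFormula B (conjʳ A B b) bΓ (AllP.++⁺ bΓ bΔ) (_ , inv∧ʳ d₁ ↭-refl)
        (perm⊢ (cutFormula A (conjˡ A B b) bΓ (conjʳ A B b ∷ bΔ) (_ , inv∧ˡ d₁ ↭-refl) (_ , inv¬∧ d₂ ↭-refl))
               (shift (¬' B) Γ Δ)))
    cutFormula (A ⇒ B) b bΓ bΔ (_ , d₁) (_ , d₂) = cutCond A B b bΓ bΔ d₁ ↭-refl d₂

    cutCond A B b bΓ bΔ (ax a) q d₂ with axiomView (axiom-↭ a q)
    ... | side a' = byAxiom (axiom-mono ∈-++⁺ˡ a')
    ... | closesPos _ n = _ , absorb n d₂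
    cutCond A B {Γ} {Δ} b bΓ bΔ (lr G r ps p) q d₂ with split₁ (↭-trans (↭-sym q) p)
    ... | inj₁ (refl , u) = cutIntro A B b bΓ bΔ (_ , permD (lr G r ps p) q) (mpcemIntro r ps u) d₂ ↭-refl
    ... | inj₂ (R , u₁ , u₂) =
      byRule (R ++ Δ) r (cutCondPrems A B b (premBounds r (All.head bFR)) (All.tail bFR) bΔ ps u₂ d₂) (++⁺ʳ Δ u₁)
      where bFR : Bnd w (_ ∷ R)
            bFR = All-resp-↭ u₁ bΓ
    cutCond A B {Γ} {Δ} b bΓ bΔ (md A₀ E G s eqs dd p) q d₂ with split (map formula E) G (↭-trans (↭-sym q) p)
    ... | inj₂ (G' , r₁ , r₂) =
      _ , md A₀ E (G' ++ Δ) s eqs dd (↭-trans (++⁺ʳ Δ r₂) (++-assoc (map formula E) G' Δ))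
    ... | inj₁ (K , r₁ , r₂) with condAt r₁
    ...   | atPos t u = cutIntro A B b bΓ bΔ (_ , permD (md A₀ E G s eqs dd p) q)
                          (viaModal s eqs dd t (↭-trans r₂ (++⁺ʳ G u))) d₂ ↭-refl

    cutCondPrems A B b [] _ _ [] _ _ = []
    cutCondPrems A B {G' = G'} {Δ} b (bM ∷ bMs) bG' bΔ (_∷_ {x = M} d ds) t d₂ =
      perm⊢ (cutCond A B b (AllP.++⁺ bM bG') bΔ d (↭-trans (++⁺ˡ M t) (shift _ M G')) d₂) (++-assoc M G' Δ)
      ∷ cutCondPrems A B b bMs bG' bΔ ds t d₂

    cutIntro A B {Γ} {Δ} b bΓ bΔ d₁ intro (ax a) q with axiomView (axiom-↭ a q)
    ... | side a' = byAxiom (axiom-mono (∈-++⁺ʳ Γ) a')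
    ... | closesPos () _
    ... | closesNeg _ n = perm⊢ (_ , absorb n (proj₂ d₁)) (++-comm Δ Γ)
    cutIntro A B {Γ} {Δ} b bΓ bΔ d₁ intro (lr G r ps p) q with split₁ (↭-trans (↭-sym q) p)
    ... | inj₁ (refl , u) = cutIntroMP A B b bΓ bΔ d₁ intro r ps u (_ , permD (lr G r ps p) q)
    ... | inj₂ (R , u₁ , u₂) =
      byRule (Γ ++ R) r (cutIntroPrems A B b bΓ (premBounds r (All.head bFR)) (All.tail bFR) d₁ intro ps u₂)
             (↭-trans (++⁺ˡ Γ u₁) (shift _ Γ R))
      where bFR : Bnd w (_ ∷ R)
            bFR = All-resp-↭ u₁ bΔ
    cutIntro A B {Γ} {Δ} b bΓ bΔ d₁ intro (md A₀ E G s eqs dd p) q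
      with split (map formula E) G (↭-trans (↭-sym q) p)
    ... | inj₂ (G' , r₁ , r₂) =
      _ , md A₀ E (Γ ++ G') s eqs dd (↭-trans (++⁺ˡ Γ r₂) (shifts Γ (map formula E)))
    ... | inj₁ (K , r₁ , r₂) with condAt r₁
    ...   | atNeg t u = cutIntroModal A B b bΓ bΔ intro s eqs dd t (↭-trans r₂ (++⁺ʳ G u))
                          (_ , permD (md A₀ E G s eqs dd p) q)

    cutIntroPrems A B b bΓ [] _ _ _ [] _ = []
    cutIntroPrems A B {Γ} {G' = G'} b bΓ (bM ∷ bMs) bG' d₁ intro (_∷_ {x = M} d ds) t =
      perm⊢ (cutIntro A B b bΓ (AllP.++⁺ bM bG') d₁ intro d (↭-trans (++⁺ˡ M t) (shift _ M G'))) (shifts Γ M)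
      ∷ cutIntroPrems A B b bΓ bMs bG' d₁ intro ds t

    cutIntroMP A B {Γ} {Δ} {G} b bΓ bΔ d₁ intro@(viaMPCEM {G₁} _ _ _ p₂ eG) (mp _ _ _) (_ ∷ pb ∷ []) eΔ d₂ =
      dupL (Γ ++ Δ) (perm⊢ (cutFormula B (cnsBound A B b) (AllP.++⁺ bG₁ bΔ) (AllP.++⁺ bΓ bG) leftB rightB) reorder)
      where
      bG₁ : Bnd w G₁
      bG₁ = All-resp-↭ eG bΓ
      bG : Bnd w G
      bG = All-resp-↭ eΔ bΔ
      leftB : ⊢ (B ∷ G₁ ++ Δ)
      leftB = cutCond A B b (cnsBound A B b ∷ bG₁) bΔ p₂ (swap _ _ ↭-refl) (proj₂ d₂)
      rightB : ⊢ (¬' B ∷ Γ ++ G)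
      rightB = perm⊢ (cutIntro A B b bΓ (cnsBound A B b ∷ bG) d₁ intro pb (swap _ _ ↭-refl)) (shift (¬' B) Γ G)
      reorder : (G₁ ++ Δ) ++ (Γ ++ G) ↭ (Γ ++ Δ) ++ (Γ ++ Δ)
      reorder = ↭-trans (solve 4 (λ g₁ d g g' → (g₁ ⊕ d) ⊕ (g ⊕ g') ⊜ (g ⊕ d) ⊕ (g₁ ⊕ g')) ↭-refl G₁ Δ Γ G)
                        (++⁺ˡ (Γ ++ Δ) (++⁺ (↭-sym eG) (↭-sym eΔ)))
    cutIntroMP A B {Γ} {Δ} {G} b bΓ bΔ d₁ intro@(viaModal {R = R} {G₁} s eqs dd t eG) (mp mt _ _) (pa ∷ pb ∷ []) eΔ _ =
      perm⊢ (mpElim true A B b (AllP.++⁺ bΓ bG) s eqs dd t ctx mt (readyRest s t)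
               (perm⊢ (cutIntro A B b bΓ (antBound A B b ∷ bG) d₁ intro pa (swap _ _ ↭-refl)) (shift A Γ G))
               (perm⊢ (cutIntro A B b bΓ (cnsBound A B b ∷ bG) d₁ intro pb (swap _ _ ↭-refl)) (shift (¬' B) Γ G)))
            (++⁺ˡ Γ (↭-sym eΔ))
      where
      bG : Bnd w G
      bG = All-resp-↭ eΔ bΔ
      ctx : Γ ++ G ↭ map formula R ++ (G₁ ++ G)
      ctx = ↭-trans (++⁺ʳ G eG) (++-assoc (map formula R) G₁ G)

    cutIntroModal A B {Γ} {Δ} {R = R₂} {G₂} b bΓ bΔ (viaMPCEM {G₁} mt ct p₁ p₂ eG) s eqs dd t eΔ d₂ =
      perm⊢ (mpElim false A B b (AllP.++⁺ bG₁ bΔ) s eqs dd t ctx mt (allReady ct)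
               (cutCond A B b (antBound A B b ∷ bG₁) bΔ p₁ (swap _ _ ↭-refl) (proj₂ d₂))
               (cutCond A B b (cnsBound A B b ∷ bG₁) bΔ p₂ (swap _ _ ↭-refl) (proj₂ d₂)))
            (++⁺ʳ Δ (↭-sym eG))
      where
      bG₁ : Bnd w G₁
      bG₁ = All-resp-↭ eG bΓ
      ctx : G₁ ++ Δ ↭ map formula R₂ ++ (G₁ ++ G₂)
      ctx = ↭-trans (++⁺ˡ G₁ eΔ) (shifts G₁ (map formula R₂))
    cutIntroModal A B {Γ} {Δ} {E = E₂} {R₂} {G₂} b bΓ bΔ (viaModal {E = E₁} {R₁} {G₁} s₁ eqs₁ dd₁ t₁ eG)
                  s₂ eqs₂ dd₂ t₂ eΔ _ with positiveLevel b
    ... | w' , refl =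
      perm⊢ (merge (G₁ ++ G₂) (lower refl) (condBounds E₁ (condsBound b bΓ t₁ eG)) (condBounds E₂ (condsBound b bΔ t₂ eΔ))
                   s₁ eqs₁ dd₁ t₁ s₂ eqs₂ dd₂ t₂)
            (↭-sym ctx)
      where
      ctx : Γ ++ Δ ↭ map formula (R₂ ++ R₁) ++ (G₁ ++ G₂)
      ctx = ↭-trans (++⁺ eG eΔ)
              (↭-trans (solve 4 (λ r₁ g₁ r₂ g₂ → (r₁ ⊕ g₁) ⊕ (r₂ ⊕ g₂) ⊜ (r₂ ⊕ r₁) ⊕ (g₁ ⊕ g₂)) ↭-refl
                                 (map formula R₁) G₁ (map formula R₂) G₂)
                       (↭-reflexive (cong (_++ (G₁ ++ G₂)) (sym (ListP.map-++ formula R₂ R₁)))))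

    mpElim s A B {k} {A₀} {E} {R} {Ctx} {H} b bC sh eqs dd t u mt oks dA dO with positiveLevel b
    ... | w' , refl = mpSteps mt R oks (antecedents ebR (All.tail eqR)) u (dropId i withoutLit)
      where
      eb : CondBnd w' E
      eb = condBounds E (condsBound b bC t u)
      ebR : CondBnd w' R
      ebR = All.tail (All-resp-↭ t eb)
      bA : δ A ≤ w'
      bA = proj₁ (All.head (All-resp-↭ t eb))
      b₀ : δ A₀ ≤ w'
      b₀ = anchorBound sh eb
      eqR : EqAnt k A₀ (cond s A B ∷ R)
      eqR = All-resp-↭ t eqs
      bL : Bnd (suc w') (idPart i A ++ map lit R)
      bL = AllP.++⁺ (idBound i A (antBound A B b)) (bmono (n≤1+n _) (litBounds ebR))
      anchoredAtA : ⊢ (lit (cond s A B) ∷ idPart i A ++ map lit R)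
      anchoredAtA = perm⊢ (reanchor (lower refl) i bA b₀ (litBounds eb) (_ , proj₂ (All.head eqR)) (_ , dd))
                          (↭-trans (++⁺ˡ (idPart i A) (map⁺ lit t)) (shift _ (idPart i A) (map lit R)))
      cutLit : ∀ s' {L} → Bnd (suc w') L → ⊢ (lit (cond s' A B) ∷ L) → ⊢ (opposite s' B ∷ Ctx) → ⊢ (L ++ Ctx)
      cutLit true bL' d d' = cutFormula B (cnsBound A B b) bL' bC d d'
      cutLit false {L} bL' d d' = perm⊢ (cutFormula B (cnsBound A B b) bC bL' d' d) (++-comm Ctx L)
      withoutLit : ⊢ (idPart i A ++ map lit R ++ Ctx)
      withoutLit = perm⊢ (cutLit s bL anchoredAtA dO) (++-assoc (idPart i A) (map lit R) Ctx)
      dropId : (b' : Bool) → ⊢ (idPart b' A ++ map lit R ++ Ctx) → ⊢ (map lit R ++ Ctx)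
      dropId false d = d
      dropId true d =
        perm⊢ (ctrL⊢ Ctx (perm⊢ (cutFormula A (antBound A B b) bC (AllP.++⁺ (AllP.++⁻ʳ (idPart i A) bL) bC) dA d)
                                 (solve 2 (λ c l → c ⊕ (l ⊕ c) ⊜ c ⊕ (c ⊕ l)) ↭-refl Ctx (map lit R))))
              (++-comm Ctx (map lit R))
      antecedents : ∀ {R'} → CondBnd w' R' → EqAnt k A₀ R' → All (λ r → ⊢ (ant r ∷ Ctx)) R'
      antecedents [] [] = []
      antecedents ((ba , _) ∷ bs) ((d , _) ∷ ds) =
        perm⊢ (cutFormula A (antBound A B b) bC (≤-trans ba (n≤1+n _) ∷ [])
                   dA (chain (lower refl) bA b₀ ba (_ , proj₂ (All.head eqR)) (_ , d)))
              (++-comm Ctx _)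
        ∷ antecedents bs ds

  cutAt : ∀ w → CutAt w
  lowerFor : ∀ w {w'} → w ≡ suc w' → CutAt w'
  cutAt w = Level.cutFormula w (lowerFor w)
  lowerFor (suc w) refl = cutAt w

  maxδ : Seq → ℕ
  maxδ [] = zero
  maxδ (F ∷ X) = δ F ⊔ maxδ X

  maxδ-bound : ∀ X → Bnd (maxδ X) X
  maxδ-bound [] = []
  maxδ-bound (F ∷ X) = m≤m⊔n (δ F) (maxδ X) ∷ bmono (m≤n⊔m (δ F) (maxδ X)) (maxδ-bound X)

  cutAdmissible : ∀ C {Γ Δ} → ⊢ (C ∷ Γ) → ⊢ (¬' C ∷ Δ) → ⊢ (Γ ++ Δ)
  cutAdmissible C {Γ} {Δ} =
    cutAt (δ C ⊔ (maxδ Γ ⊔ maxδ Δ)) C (m≤m⊔n _ _)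
      (bmono (≤-trans (m≤m⊔n (maxδ Γ) (maxδ Δ)) (m≤n⊔m (δ C) _)) (maxδ-bound Γ))
      (bmono (≤-trans (m≤n⊔m (maxδ Γ) (maxδ Δ)) (m≤n⊔m (δ C) _)) (maxδ-bound Δ))

mpIn : ∀ {V : Set} (i m c : Bool) → m ≡ true → ∀ (A B : Formula V) Γ →
       GL i m c (((A ∷ ¬' (A ⇒ B) ∷ Γ) ∷ (¬' B ∷ ¬' (A ⇒ B) ∷ Γ) ∷ []) / (¬' (A ⇒ B) ∷ Γ))
mpIn i true false refl A B Γ = inj₂ (mpg A B Γ)
mpIn i true true refl A B Γ = inj₂ (inj₁ (mpg A B Γ))

mpcemIn : ∀ {V : Set} (i m c : Bool) → m ≡ true → c ≡ true → ∀ (A B : Formula V) Γ →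
          GL i m c (((A ∷ (A ⇒ B) ∷ Γ) ∷ (B ∷ (A ⇒ B) ∷ Γ) ∷ []) / ((A ⇒ B) ∷ Γ))
mpcemIn i true true refl refl A B Γ = inj₂ (inj₂ (mpcemg A B Γ))

ckIn : ∀ {V : Set} (i m c : Bool) → c ≡ false → ∀ (A₀ B₀ : Formula V) ps Γ →
       GL i m c ((eqPrems A₀ ps ++ ((idPart i A₀ ++ map negB ps ++ B₀ ∷ []) ∷ [])) / (map negImp ps ++ (A₀ ⇒ B₀) ∷ Γ))
ckIn i false false refl A₀ B₀ ps Γ = ckg A₀ B₀ ps Γ
ckIn i true false refl A₀ B₀ ps Γ = inj₁ (ckg A₀ B₀ ps Γ)

ckcemIn : ∀ {V : Set} (i m c : Bool) → c ≡ true → ∀ (A₀ B₀ : Formula V) pos neg Γ →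
          GL i m c ((eqPrems A₀ (pos ++ neg) ++ ((idPart i A₀ ++ B₀ ∷ map proj₂ pos ++ map negB neg) ∷ []))
                    / ((A₀ ⇒ B₀) ∷ map posImp pos ++ map negImp neg ++ Γ))
ckcemIn i false true refl A₀ B₀ pos neg Γ = ckcemg A₀ B₀ pos neg Γ
ckcemIn i true true refl A₀ B₀ pos neg Γ = inj₁ (ckcemg A₀ B₀ pos neg Γ)

module Translation {V : Set} (i m c : Bool) where
  open Calculus {V} i m c
  open CutElimination {V} i m c using (cutAdmissible)

  identity : ∀ A Γ → ⊢ (A ∷ ¬' A ∷ Γ)
  identity ⊥' Γ = byAxiom (verum (there (here refl)))
  identity (var v) Γ = byAxiom (atomic (atVar v) (here refl) (there (here refl)))
  identity (A ⇒ B) Γ = byAxiom (atomic (atImp A B) (here refl) (there (here refl)))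
  identity (¬' A) Γ = byRule (¬' A ∷ Γ) (nneg A) (identity A Γ ∷ []) (swap _ _ ↭-refl)
  identity (A ∧' B) Γ = byRule (¬' (A ∧' B) ∷ Γ) (conj A B) (viaA ∷ viaB ∷ []) ↭-refl
    where
    viaA : ⊢ (A ∷ ¬' (A ∧' B) ∷ Γ)
    viaA = byRule (A ∷ Γ) (nconj A B) (perm⊢ (identity A (¬' B ∷ Γ)) (shifts [ A ] (¬' A ∷ ¬' B ∷ [])) ∷ [])
                  (swap _ _ ↭-refl)
    viaB : ⊢ (B ∷ ¬' (A ∧' B) ∷ Γ)
    viaB = byRule (B ∷ Γ) (nconj A B)
                  (perm⊢ (identity B (¬' A ∷ Γ))
                         (solve 4 (λ b nb na g → b ⊕ (nb ⊕ (na ⊕ g)) ⊜ na ⊕ (nb ⊕ (b ⊕ g))) ↭-refl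
                                  [ B ] [ ¬' B ] [ ¬' A ] Γ)
                   ∷ [])
                  (swap _ _ ↭-refl)

  -- Every formula is provably equivalent to itself (the anchor's own equivalence premise).
  reflexive : ∀ A → Equiv⊢ A A
  reflexive A = perm⊢ (identity A []) (swap _ _ ↭-refl) , perm⊢ (identity A []) (swap _ _ ↭-refl)

  positives : List (Fm × Fm) → List Cond
  positives = map (λ p → cond true (proj₁ p) (proj₂ p))

  negatives : List (Fm × Fm) → List Cond
  negatives = map (λ p → cond false (proj₁ p) (proj₂ p))

  lits-signed : ∀ pos neg → map lit (positives pos ++ negatives neg) ≡ map proj₂ pos ++ map negB neg
  lits-signed pos neg = ≡-trans (ListP.map-++ lit (positives pos) (negatives neg))
                                (cong₂ _++_ (sym (ListP.map-∘ pos)) (sym (ListP.map-∘ neg)))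

  formulas-signed : ∀ pos neg → map formula (positives pos ++ negatives neg) ≡ map posImp pos ++ map negImp neg
  formulas-signed pos neg = ≡-trans (ListP.map-++ formula (positives pos) (negatives neg))
                                    (cong₂ _++_ (sym (ListP.map-∘ pos)) (sym (ListP.map-∘ neg)))

  allNegative : ∀ ps → All Negative (negatives ps)
  allNegative ps = AllP.map⁺ (All.tabulate (λ _ → refl))

  eqUnpack : ∀ A₀ ps → All ⊢_ (eqPrems A₀ ps) → All (λ p → Equiv⊢ A₀ (proj₁ p)) ps
  eqUnpack A₀ [] _ = []
  eqUnpack A₀ (p ∷ ps) (a ∷ b ∷ r) = (a , b) ∷ eqUnpack A₀ ps r

  eqSigned : ∀ A₀ pos neg → All ⊢_ (eqPrems A₀ (pos ++ neg)) → EqAnt⊢ A₀ (positives pos ++ negatives neg)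
  eqSigned A₀ pos neg eqs with AllP.++⁻ pos (eqUnpack A₀ (pos ++ neg) eqs)
  ... | eqPos , eqNeg = AllP.++⁺ (AllP.map⁺ eqPos) (AllP.map⁺ eqNeg)

  ckcemStep : c ≡ true → ∀ A₀ B₀ pos neg Γ →
              All ⊢_ (eqPrems A₀ (pos ++ neg) ++ ((idPart i A₀ ++ B₀ ∷ map proj₂ pos ++ map negB neg) ∷ [])) →
              ⊢ ((A₀ ⇒ B₀) ∷ map posImp pos ++ map negImp neg ++ Γ)
  ckcemStep ct A₀ B₀ pos neg Γ prs with AllP.++⁻ (eqPrems A₀ (pos ++ neg)) prs
  ... | eqs , (d ∷ []) =
    byModal A₀ (cond true A₀ B₀ ∷ positives pos ++ negatives neg) Γ
      (B₀ , _ , ↭-refl , λ cf → ⊥-elim (noCEM (≡-trans (sym ct) cf)))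
      (reflexive A₀ ∷ eqSigned A₀ pos neg eqs)
      (subst (λ L → ⊢ (idPart i A₀ ++ B₀ ∷ L)) (sym (lits-signed pos neg)) d)
      (prep _ (↭-trans (↭-sym (++-assoc (map posImp pos) (map negImp neg) Γ))
                       (↭-reflexive (cong (_++ Γ) (sym (formulas-signed pos neg))))))
    where noCEM : true ≡ false → ⊥
          noCEM ()

  ckStep : ∀ A₀ B₀ ps Γ → All ⊢_ (eqPrems A₀ ps ++ ((idPart i A₀ ++ map negB ps ++ B₀ ∷ []) ∷ [])) →
           ⊢ (map negImp ps ++ (A₀ ⇒ B₀) ∷ Γ)
  ckStep A₀ B₀ ps Γ prs with AllP.++⁻ (eqPrems A₀ ps) prs
  ... | eqs , (d ∷ []) =
    byModal A₀ (cond true A₀ B₀ ∷ negatives ps) Γ (B₀ , _ , ↭-refl , λ _ → allNegative ps)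
      (reflexive A₀ ∷ eqSigned A₀ [] ps eqs)
      (perm⊢ d (++⁺ˡ (idPart i A₀) (↭-trans (++-comm (map negB ps) [ B₀ ])
                                             (prep B₀ (↭-reflexive (ListP.map-∘ ps))))))
      (↭-trans (shift (A₀ ⇒ B₀) (map negImp ps) Γ) (prep _ (++⁺ʳ Γ (↭-reflexive (ListP.map-∘ ps)))))

  glRule : ∀ (m' c' : Bool) → m ≡ m' → c ≡ c' → ∀ {ps cc} → GL i m' c' (ps / cc) → All ⊢_ ps → ⊢ cc
  glRule false false _ _ (ckg A₀ B₀ ps Γ) prs = ckStep A₀ B₀ ps Γ prs
  glRule true false _ _ (inj₁ (ckg A₀ B₀ ps Γ)) prs = ckStep A₀ B₀ ps Γ prs
  glRule true false mt _ (inj₂ (mpg A B Γ)) (d₁ ∷ d₂ ∷ []) = byRule Γ (mp mt A B) (d₁ ∷ d₂ ∷ []) ↭-refl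
  glRule false true _ ct (ckcemg A₀ B₀ pos neg Γ) prs = ckcemStep ct A₀ B₀ pos neg Γ prs
  glRule true true _ ct (inj₁ (ckcemg A₀ B₀ pos neg Γ)) prs = ckcemStep ct A₀ B₀ pos neg Γ prs
  glRule true true mt _ (inj₂ (inj₁ (mpg A B Γ))) (d₁ ∷ d₂ ∷ []) = byRule Γ (mp mt A B) (d₁ ∷ d₂ ∷ []) ↭-refl
  glRule true true mt ct (inj₂ (inj₂ (mpcemg A B Γ))) (d₁ ∷ d₂ ∷ []) =
    byRule Γ (mpcem mt ct A B) (d₁ ∷ d₂ ∷ []) ↭-refl

  fromG : ∀ {X} → G⊢ (GL i m c ∪ Cut) X → ⊢ X
  fromGAll : ∀ {ps} → All (G⊢ (GL i m c ∪ Cut)) ps → All ⊢_ ps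
  fromG (perm p d) = perm⊢ (fromG d) p
  fromG (ax A Γ) = identity A Γ
  fromG (ax⊥ Γ) = byAxiom (verum (here refl))
  fromG (¬∧ {Γ} {A} {B} d) = byRule Γ (nconj A B) (fromG d ∷ []) ↭-refl
  fromG (∧r {Γ} {A} {B} d₁ d₂) = byRule Γ (conj A B) (fromG d₁ ∷ fromG d₂ ∷ []) ↭-refl
  fromG (¬¬ {Γ} {A} d) = byRule Γ (nneg A) (fromG d ∷ []) ↭-refl
  fromG (rule (inj₁ r) prs) = glRule m c refl refl r (fromGAll prs)
  fromG (rule (inj₂ (cut Γ Δ A)) (d₁ ∷ d₂ ∷ [])) = cutAdmissible A (fromG d₁) (fromG d₂)
  fromGAll [] = []
  fromGAll (d ∷ ds) = fromG d ∷ fromGAll ds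

  signedPairs : List Cond → List (Fm × Fm) × List (Fm × Fm)
  signedPairs [] = [] , []
  signedPairs (cond true A B ∷ E) = map₁ ((A , B) ∷_) (signedPairs E)
  signedPairs (cond false A B ∷ E) = map₂ ((A , B) ∷_) (signedPairs E)

  signedPairs-↭ : ∀ E → E ↭ positives (proj₁ (signedPairs E)) ++ negatives (proj₂ (signedPairs E))
  signedPairs-↭ [] = ↭-refl
  signedPairs-↭ (cond true A B ∷ E) = prep _ (signedPairs-↭ E)
  signedPairs-↭ (cond false A B ∷ E) =
    ↭-trans (prep _ (signedPairs-↭ E)) (↭-sym (shift _ (positives (proj₁ (signedPairs E))) _))

  noPositives : ∀ E → All Negative E → proj₁ (signedPairs E) ≡ []
  noPositives [] _ = refl
  noPositives (cond false A B ∷ E) (_ ∷ neg) = noPositives E neg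

  R : RuleSet V
  R = GL i m c

  eqPremsG : ∀ A₀ ps → All (λ p → G⊢ R (¬' A₀ ∷ proj₁ p ∷ []) × G⊢ R (¬' proj₁ p ∷ A₀ ∷ [])) ps →
             All (G⊢ R) (eqPrems A₀ ps)
  eqPremsG A₀ [] [] = []
  eqPremsG A₀ (p ∷ ps) ((a , b) ∷ r) = a ∷ b ∷ eqPremsG A₀ ps r

  modalToG : ∀ (b : Bool) → c ≡ b → ∀ {X} A₀ B₀ pos neg G → (b ≡ false → pos ≡ []) →
             All (λ p → G⊢ R (¬' A₀ ∷ proj₁ p ∷ []) × G⊢ R (¬' proj₁ p ∷ A₀ ∷ [])) (pos ++ neg) →
             G⊢ R (idPart i A₀ ++ B₀ ∷ map proj₂ pos ++ map negB neg) →
             X ↭ (A₀ ⇒ B₀) ∷ map posImp pos ++ map negImp neg ++ G → G⊢ R X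
  modalToG true ct A₀ B₀ pos neg G _ eqs d p =
    perm (↭-sym p) (rule (ckcemIn i m c ct A₀ B₀ pos neg G) (AllP.++⁺ (eqPremsG A₀ (pos ++ neg) eqs) (d ∷ [])))
  modalToG false cf A₀ B₀ pos neg G noPos eqs d p with noPos refl
  ... | refl =
    perm (↭-sym (↭-trans p (↭-sym (shift (A₀ ⇒ B₀) (map negImp neg) G))))
      (rule (ckIn i m c cf A₀ B₀ neg G)
        (AllP.++⁺ (eqPremsG A₀ neg eqs) (perm (++⁺ˡ (idPart i A₀) (↭-sym (++-comm (map negB neg) [ B₀ ]))) d ∷ [])))

  unsigned : ∀ {P : Fm → Set} pos neg → All (λ e → P (ant e)) (positives pos ++ negatives neg) →
             All (λ p → P (proj₁ p)) (pos ++ neg)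
  unsigned pos neg a with AllP.++⁻ (positives pos) a
  ... | a₁ , a₂ = AllP.++⁺ (AllP.map⁻ a₁) (AllP.map⁻ a₂)

  axiomToG : ∀ {X} → Axiom X → G⊢ R X
  axiomToG (atomic a p n) with ∈⇒↭ p
  ... | Y , q with ∈-resp-↭ q n
  ...   | here ()
  ...   | there n' with ∈⇒↭ n'
  ...     | Z , q' = perm (↭-sym (↭-trans q (prep _ q'))) (ax _ Z)
  axiomToG (verum v) with ∈⇒↭ v
  ... | Y , q = perm (↭-sym q) (ax⊥ Y)

  toG : ∀ {n X} → D n X → G⊢ R X
  toGEq : ∀ {n A₀ E} → EqAnt n A₀ E → All (λ e → G⊢ R (¬' A₀ ∷ ant e ∷ []) × G⊢ R (¬' ant e ∷ A₀ ∷ [])) E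
  toG (ax a) = axiomToG a
  toG (lr G (conj A B) (d₁ ∷ d₂ ∷ []) p) = perm (↭-sym p) (∧r (toG d₁) (toG d₂))
  toG (lr G (nconj A B) (d ∷ []) p) = perm (↭-sym p) (¬∧ (toG d))
  toG (lr G (nneg A) (d ∷ []) p) = perm (↭-sym p) (¬¬ (toG d))
  toG (lr G (mp mt A B) (d₁ ∷ d₂ ∷ []) p) = perm (↭-sym p) (rule (mpIn i m c mt A B G) (toG d₁ ∷ toG d₂ ∷ []))
  toG (lr G (mpcem mt ct A B) (d₁ ∷ d₂ ∷ []) p) =
    perm (↭-sym p) (rule (mpcemIn i m c mt ct A B G) (toG d₁ ∷ toG d₂ ∷ []))
  toG (md A₀ E G (B₀ , E' , t , neg) eqs dd p) =
    modalToG c refl A₀ B₀ pos negs G (λ cf → noPositives E' (neg cf))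
      (unsigned pos negs (All.tail (All-resp-↭ split-E (toGEq eqs))))
      (perm (↭-trans (++⁺ˡ (idPart i A₀) (map⁺ lit split-E))
                     (↭-reflexive (cong (λ L → idPart i A₀ ++ B₀ ∷ L) (lits-signed pos negs))))
            (toG dd))
      (↭-trans p (↭-trans (++⁺ʳ G (map⁺ formula split-E))
        (prep _ (↭-trans (↭-reflexive (cong (_++ G) (formulas-signed pos negs)))
                         (++-assoc (map posImp pos) (map negImp negs) G)))))
    where
    pos negs : List (Fm × Fm)
    pos = proj₁ (signedPairs E')
    negs = proj₂ (signedPairs E')
    split-E : E ↭ cond true A₀ B₀ ∷ positives pos ++ negatives negs
    split-E = ↭-trans t (prep _ (signedPairs-↭ E'))
  toGEq [] = []
  toGEq ((d , d') ∷ ds) = (toG d , toG d') ∷ toGEq ds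

Valid : List PForm → Set
Valid L = ∀ v → Any (λ φ → peval v φ ≡ true) L

valid-↭ : ∀ {L L'} → Valid L → L ↭ L' → Valid L'
valid-↭ val p v = Any-resp-↭ p (val v)

valid-weaken : ∀ {φ ψ L} → (∀ v → peval v φ ≡ true → peval v ψ ≡ true) → Valid (φ ∷ L) → Valid (ψ ∷ L)
valid-weaken f val v with val v
... | here t = here (f v t)
... | there a = there a

nand-true : ∀ a b → not (a ∧ b) ≡ true → not a ≡ true ⊎ not b ≡ true
nand-true false _ _ = inj₁ refl
nand-true true _ t = inj₂ t

valid-nand : ∀ {φ ψ L} → Valid (p¬ (p∧ φ ψ) ∷ L) → Valid (p¬ φ ∷ p¬ ψ ∷ L)
valid-nand {φ} {ψ} val v with val v
... | there a = there (there a)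
... | here t with nand-true (peval v φ) (peval v ψ) t
...   | inj₁ t₁ = here t₁
...   | inj₂ t₂ = there (here t₂)

∧-true : ∀ {a b} → (a ∧ b) ≡ true → a ≡ true × b ≡ true
∧-true {true} t = refl , t

data Literal : PForm → Set where
  lvar : ∀ n → Literal (pvar n)
  lneg : ∀ n → Literal (p¬ (pvar n))
  lbot : Literal p⊥
  ltop : Literal (p¬ p⊥)

data Shape : PForm → Set where
  literal : ∀ {φ} → Literal φ → Shape φ
  dneg    : ∀ φ → Shape (p¬ (p¬ φ))
  nand    : ∀ φ ψ → Shape (p¬ (p∧ φ ψ))
  and     : ∀ φ ψ → Shape (p∧ φ ψ)

shape : ∀ φ → Shape φ
shape p⊥ = literal lbot
shape (pvar n) = literal (lvar n)
shape (p¬ p⊥) = literal ltop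
shape (p¬ (pvar n)) = literal (lneg n)
shape (p¬ (p¬ φ)) = dneg φ
shape (p¬ (p∧ φ ψ)) = nand φ ψ
shape (p∧ φ ψ) = and φ ψ

-- Is φ the negation of variable n?  (Decides the valuation used to close literal sequents.)
negVar? : ∀ n φ → Dec (p¬ (pvar n) ≡ φ)
negVar? n (p¬ (pvar k)) with n ℕ.≟ k
... | yes refl = yes refl
... | no n≢k = no λ { refl → n≢k refl }
negVar? n p⊥ = no λ ()
negVar? n (pvar _) = no λ ()
negVar? n (p¬ p⊥) = no λ ()
negVar? n (p¬ (p¬ _)) = no λ ()
negVar? n (p¬ (p∧ _ _)) = no λ ()
negVar? n (p∧ _ _) = no λ ()

-- Fuel for the proof search: every decomposition step strictly decreases the total size.
size : PForm → ℕ
size p⊥ = 1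
size (pvar _) = 1
size (p¬ φ) = suc (size φ)
size (p∧ φ ψ) = suc (suc (size φ + size ψ))

sizes : List PForm → ℕ
sizes [] = 0
sizes (φ ∷ L) = size φ + sizes L

shrink : ∀ φ {n f} → size φ + n ≤ suc f → n ≤ f
shrink p⊥ (s≤s le) = le
shrink (pvar _) (s≤s le) = le
shrink (p¬ φ) (s≤s le) = ≤-trans (m≤n+m _ (size φ)) le
shrink (p∧ φ ψ) (s≤s le) = ≤-trans (m≤n+m _ (suc (size φ + size ψ))) le

noFuel : ∀ φ {n} → size φ + n ≤ zero → ⊥
noFuel p⊥ ()
noFuel (pvar _) ()
noFuel (p¬ _) ()
noFuel (p∧ _ _) ()

module Tautologies {V : Set} (i m c : Bool) (σ : ℕ → Formula V) where
  open Calculus {V} i m c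
  open Translation {V} i m c using (identity)

  σ* : List PForm → Seq
  σ* = map (psubst σ)

  complementary : ∀ {A X} → A ∈ X → ¬' A ∈ X → ⊢ X
  complementary {A} A∈ ¬A∈ with ∈⇒↭ A∈
  ... | Y , p with ∈-resp-↭ p ¬A∈
  ...   | here ()
  ...   | there ¬A∈Y with ∈⇒↭ ¬A∈Y
  ...     | Z , q = perm⊢ (identity A Z) (↭-sym (↭-trans p (prep A q)))

  -- A valid list of literals contains ¬⊥ or a complementary pair: make the variables whose
  -- negation occurs true, then a true member is ¬⊥ or a variable whose negation also occurs.
  closeLiterals : ∀ L → All Literal L → Valid L → ⊢ (σ* L)
  closeLiterals L lits val with find (val (λ n → does (any? (negVar? n) L)))
  ... | φ , φ∈ , true-φ = close (All.lookup lits φ∈) φ∈ true-φ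
    where
    close : ∀ {φ} → Literal φ → φ ∈ L → peval (λ n → does (any? (negVar? n) L)) φ ≡ true → ⊢ (σ* L)
    close (lvar n) φ∈ t with any? (negVar? n) L
    ... | yes ¬n∈ = complementary (∈-map⁺ (psubst σ) φ∈) (∈-map⁺ (psubst σ) ¬n∈)
    close (lvar n) φ∈ () | no _
    close (lneg n) φ∈ t with any? (negVar? n) L
    ... | no ¬n∉ = ⊥-elim (¬n∉ φ∈)
    close (lneg n) φ∈ () | yes _
    close lbot φ∈ ()
    close ltop φ∈ _ = byAxiom (verum (∈-map⁺ (psubst σ) φ∈))

  -- Decompose the formulas in todo one by one; the rules used are invertible, so validity is kept.
  search : ∀ f todo lits → sizes todo ≤ f → All Literal lits → Valid (todo ++ lits) → ⊢ (σ* (todo ++ lits))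
  search _ [] lits _ ok val = closeLiterals lits ok val
  search zero (φ ∷ _) _ le _ _ = ⊥-elim (noFuel φ le)
  search (suc f) (φ ∷ todo) lits le ok val with shape φ
  ... | literal l =
    perm⊢ (search f todo (φ ∷ lits) (shrink φ le) (l ∷ ok) (valid-↭ val (↭-sym (shift φ todo lits))))
          (map⁺ (psubst σ) (shift φ todo lits))
  ... | dneg ψ =
    byRule (σ* (todo ++ lits)) (nneg _)
      (search f (ψ ∷ todo) lits (≤-trans (n≤1+n _) (≤-pred le)) ok
              (valid-weaken (λ v t → ≡-trans (sym (not-involutive _)) t) val) ∷ [])
      ↭-refl
  ... | nand φ₁ φ₂ =
    byRule (σ* (todo ++ lits)) (nconj _ _) (search f (p¬ φ₁ ∷ p¬ φ₂ ∷ todo) lits fuel ok (valid-nand val) ∷ []) ↭-refl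
    where fuel : suc (size φ₁) + (suc (size φ₂) + sizes todo) ≤ f
          fuel = subst (_≤ f) (≡-trans (cong (λ k → suc (suc k)) (+-assoc (size φ₁) (size φ₂) (sizes todo)))
                                      (sym (cong suc (+-suc (size φ₁) (size φ₂ + sizes todo)))))
                       (≤-pred le)
  ... | and φ₁ φ₂ =
    byRule (σ* (todo ++ lits)) (conj _ _)
      (search f (φ₁ ∷ todo) lits (≤-trans (+-monoˡ-≤ (sizes todo) (m≤m+n (size φ₁) (size φ₂))) fuel) ok
              (valid-weaken (λ v t → proj₁ (∧-true t)) val)
       ∷ search f (φ₂ ∷ todo) lits (≤-trans (+-monoˡ-≤ (sizes todo) (m≤n+m (size φ₂) (size φ₁))) fuel) ok
              (valid-weaken (λ v t → proj₂ (∧-true t)) val)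
       ∷ [])
      ↭-refl
    where fuel : size φ₁ + size φ₂ + sizes todo ≤ f
          fuel = ≤-trans (n≤1+n _) (≤-pred le)

module Hilbert {V : Set} (i m c : Bool) where
  open Calculus {V} i m c
  open CutElimination {V} i m c using (cutAdmissible)
  open Translation {V} i m c using (identity; reflexive)

  tautology : ∀ {A} → TautInstance A → ⊢ (A ∷ [])
  tautology (φ , σ , T , refl) = Tautologies.search i m c σ (sizes [ φ ]) [ φ ] [] ≤-refl [] (λ v → here (T v))

  fromImplication : ∀ X Y → ⊢ ((X ⊃ Y) ∷ []) → ⊢ (¬' X ∷ Y ∷ [])
  fromImplication X Y (n , d) = n , permD (inv¬¬ (inv¬∧ d ↭-refl) (swap _ _ ↭-refl)) (swap _ _ ↭-refl)

  toImplication : ∀ X Y → ⊢ (¬' X ∷ Y ∷ []) → ⊢ ((X ⊃ Y) ∷ [])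
  toImplication X Y d =
    byRule [] (nconj X (¬' Y)) (byRule (¬' X ∷ []) (nneg Y) (perm⊢ d (swap _ _ ↭-refl) ∷ []) (swap _ _ ↭-refl) ∷ []) ↭-refl

  congruence : ∀ X Y B → ⊢ (¬' X ∷ Y ∷ []) → ⊢ (¬' Y ∷ X ∷ []) → ⊢ (¬' (X ⇒ B) ∷ (Y ⇒ B) ∷ [])
  congruence X Y B e₁ e₂ =
    byModal Y (cond true Y B ∷ cond false X B ∷ []) [] (B , _ , ↭-refl , λ _ → refl ∷ [])
      (reflexive Y ∷ (e₂ , e₁) ∷ []) (wkL⊢ (idPart i Y) (identity B [])) (swap _ _ ↭-refl)

  ck-congruence : ∀ A A' B → ⊢ ((A ⟺ A') ∷ []) → ⊢ (((A ⇒ B) ⟺ (A' ⇒ B)) ∷ [])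
  ck-congruence A A' B (n , d) =
    byRule [] (conj _ _) (toImplication _ _ (congruence A A' B e₁ e₂) ∷ toImplication _ _ (congruence A' A B e₂ e₁) ∷ []) ↭-refl
    where e₁ : ⊢ (¬' A ∷ A' ∷ [])
          e₁ = fromImplication A A' (n , inv∧ˡ d ↭-refl)
          e₂ : ⊢ (¬' A' ∷ A ∷ [])
          e₂ = fromImplication A' A (n , inv∧ʳ d ↭-refl)

  ck-necessitation : ∀ A B → ⊢ (B ∷ []) → ⊢ ((A ⇒ B) ∷ [])
  ck-necessitation A B d =
    byModal A (cond true A B ∷ []) [] (B , [] , ↭-refl , λ _ → []) (reflexive A ∷ []) (wkL⊢ (idPart i A) d) ↭-refl

  unfoldConj : ∀ C Cs {X} → ⊢ (¬' ⋀⁺ C Cs ∷ X) → ⊢ (map ¬'_ (C ∷ Cs) ++ X)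
  unfoldConj C [] d = d
  unfoldConj C (C' ∷ Cs) {X} (n , d) =
    perm⊢ (unfoldConj C' Cs (n , permD (inv¬∧ d ↭-refl) (swap _ _ ↭-refl))) (shift (¬' C) (map ¬'_ (C' ∷ Cs)) X)

  foldConj : ∀ C Cs {X} → ⊢ (map ¬'_ (C ∷ Cs) ++ X) → ⊢ (¬' ⋀⁺ C Cs ∷ X)
  foldConj C [] d = d
  foldConj C (C' ∷ Cs) {X} d =
    byRule X (nconj C (⋀⁺ C' Cs))
      (perm⊢ (foldConj C' Cs (perm⊢ d (↭-sym (shift (¬' C) (map ¬'_ (C' ∷ Cs)) X)))) (swap _ _ ↭-refl) ∷ []) ↭-refl

  ck-monotonicity : ∀ A B B₁ Bs → ⊢ ((⋀⁺ B₁ Bs ⊃ B) ∷ []) →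
                    ⊢ ((⋀⁺ (A ⇒ B₁) (map (A ⇒_) Bs) ⊃ (A ⇒ B)) ∷ [])
  ck-monotonicity A B B₁ Bs d =
    toImplication _ _ (foldConj (A ⇒ B₁) (map (A ⇒_) Bs) modal)
    where
    Es : List Cond
    Es = map (cond false A) (B₁ ∷ Bs)
    negatedConds : map ¬'_ (map (A ⇒_) (B₁ ∷ Bs)) ≡ map formula Es
    negatedConds = ≡-trans (sym (ListP.map-∘ (B₁ ∷ Bs))) (ListP.map-∘ (B₁ ∷ Bs))
    premise : ⊢ (idPart i A ++ B ∷ map lit Es)
    premise = subst (λ L → ⊢ (idPart i A ++ B ∷ L)) (ListP.map-∘ (B₁ ∷ Bs))
                (wkL⊢ (idPart i A) (perm⊢ (unfoldConj B₁ Bs (fromImplication _ _ d)) (++-comm (map ¬'_ (B₁ ∷ Bs)) [ B ])))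
    modal : ⊢ (map ¬'_ (map (A ⇒_) (B₁ ∷ Bs)) ++ (A ⇒ B) ∷ [])
    modal = byModal A (cond true A B ∷ Es) [] (B , Es , ↭-refl , λ _ → AllP.map⁺ (All.tabulate (λ _ → refl)))
              (reflexive A ∷ AllP.map⁺ (All.tabulate (λ _ → reflexive A)))
              premise
              (↭-trans (++-comm (map ¬'_ (map (A ⇒_) (B₁ ∷ Bs))) [ A ⇒ B ])
                       (prep _ (↭-reflexive (≡-trans negatedConds (sym (ListP.++-identityʳ _))))))

  id-axiom : i ≡ true → ∀ A → ⊢ ((A ⇒ A) ∷ [])
  id-axiom it A = byModal A (cond true A A ∷ []) [] (A , [] , ↭-refl , λ _ → []) (reflexive A ∷ [])
                    (subst (λ b → ⊢ (idPart b A ++ A ∷ [])) (sym it) (proj₁ (reflexive A))) ↭-refl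

  mp-axiom : m ≡ true → ∀ A B → ⊢ (((A ⇒ B) ⊃ (A ⊃ B)) ∷ [])
  mp-axiom mt A B =
    toImplication _ _ (byRule (¬' (A ⇒ B) ∷ []) (nconj A (¬' B)) (viaMP ∷ []) (swap _ _ ↭-refl))
    where
    viaMP : ⊢ (¬' A ∷ ¬' ¬' B ∷ ¬' (A ⇒ B) ∷ [])
    viaMP = byRule (¬' A ∷ ¬' ¬' B ∷ []) (mp mt A B)
              (perm⊢ (identity A (¬' (A ⇒ B) ∷ ¬' ¬' B ∷ [])) (prep A (swap _ _ ↭-refl))
               ∷ perm⊢ (identity (¬' B) (¬' (A ⇒ B) ∷ ¬' A ∷ [])) (prep (¬' B) (++-comm [ ¬' ¬' B ] _))
               ∷ [])
              (++-comm (¬' A ∷ ¬' ¬' B ∷ []) [ ¬' (A ⇒ B) ])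

  cem-axiom : c ≡ true → ∀ A B → ⊢ (((A ⇒ B) ∨' (A ⇒ ¬' B)) ∷ [])
  cem-axiom ct A B =
    byRule [] (nconj _ _)
      (byRule (¬' ¬' (A ⇒ ¬' B) ∷ []) (nneg (A ⇒ B))
        (byRule ((A ⇒ B) ∷ []) (nneg (A ⇒ ¬' B)) (both ∷ []) (swap _ _ ↭-refl) ∷ []) ↭-refl ∷ [])
      ↭-refl
    where
    both : ⊢ ((A ⇒ ¬' B) ∷ (A ⇒ B) ∷ [])
    both = byModal A (cond true A B ∷ cond true A (¬' B) ∷ []) [] (B , _ , ↭-refl , λ cf → ⊥-elim (noCEM (≡-trans (sym ct) cf)))
             (reflexive A ∷ reflexive A ∷ []) (wkL⊢ (idPart i A) (identity B [])) (swap _ _ ↭-refl)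
      where noCEM : true ≡ false → ⊥
            noCEM ()

  hilbertRule : ∀ (i' m' c' : Bool) → i ≡ i' → m ≡ m' → c ≡ c' → ∀ {ps cc} → HL i' m' c' (ps / cc) →
                All (λ Γ → ⊢ (⋁ Γ ∷ [])) ps → ⊢ (⋁ cc ∷ [])
  hilbertRule _ _ _ _ _ _ (inj₁ (ck-cong A A' B)) (d ∷ []) = ck-congruence A A' B d
  hilbertRule _ _ _ _ _ _ (inj₁ (ck-mono0 A B)) (d ∷ []) = ck-necessitation A B d
  hilbertRule _ _ _ _ _ _ (inj₁ (ck-mono A B B₁ Bs)) (d ∷ []) = ck-monotonicity A B B₁ Bs d
  hilbertRule true _ _ it _ _ (inj₂ (inj₁ (id-ax A))) [] = id-axiom it A
  hilbertRule _ true _ _ mt _ (inj₂ (inj₂ (inj₁ (mp-ax A B)))) [] = mp-axiom mt A B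
  hilbertRule _ _ true _ _ ct (inj₂ (inj₂ (inj₂ (cem-ax A B)))) [] = cem-axiom ct A B

  -- Hilbert derivations become D derivations; modus ponens is a cut.
  hilbert : ∀ {A} → H⊢ (HL i m c) A → ⊢ (A ∷ [])
  hilbertAll : ∀ {ps} → All (λ Γ → H⊢ (HL i m c) (⋁ Γ)) ps → All (λ Γ → ⊢ (⋁ Γ ∷ [])) ps
  hilbert (taut t) = tautology t
  hilbert (mpH {A} {B} d₁ d₂) = cutAdmissible A (hilbert d₂) (fromImplication A B (hilbert d₁))
  hilbert (rule r prs) = hilbertRule i m c refl refl refl r (hilbertAll prs)
  hilbertAll [] = []
  hilbertAll (d ∷ ds) = hilbert d ∷ hilbertAll ds

theorem6p13 : (V : Set) (id mp cem : Bool) →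
    ((A : Formula V) → H⊢ (HL id mp cem) A → G⊢ (GL id mp cem) (A ∷ []))
    × Admissible (GL id mp cem) (Cut {V})
theorem6p13 V i m c =
  (λ A h → Translation.toG i m c (proj₂ (Hilbert.hilbert i m c h))) ,
  (λ Γ d → Translation.toG i m c (proj₂ (Translation.fromG i m c d)))
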